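{- For every pair of integers $n\ge 1$, $m\ge 1$, the decision $$\mathcal{S}(n,m):=\begin{cases} 0, & \text{if } n=1 \text{ or } m=1,\\ 1, & \text{if } (n,m)=(4,4),\\ 3, & \text{if } (n,m)=(6,4),\\ 5, & \text{if } (n,m)=(10,4),\\ n_<, & \text{otherwise},\end{cases}$$ is an optimal decision at board state $(n,m)$ of bipartite Guess Who. Here $n_<:=1$ if $n=2$, and $n_<:=\left\lfloor \frac{n}{4}\right\rfloor+\left\lfloor\frac{n+1}{4}\right\rfloor$ if $n\ge 3$.
   Context: Bipartite Guess Who is the following two-player zero-sum game of chance. A board state $(n,m)$ (with integers $n,m\ge 1$) means: the player to move has $n$ remaining suspects, one of which (uniformly at random) is the opponent's mystery person, and the opponent has $m$ remaining suspects. At board state $(n,m)$ the player to move chooses a decision: either the decision $0$ ("guess"), which ends the game and wins for the mover with probability $1/n$ and loses otherwise; or an integer $k$ with $1\le k\le n/2$ (asking whether the mystery person lies in a chosen set of $k$ of the $n$ suspects), after which, with probability $k/n$, it becomes the opponent's turn at board state $(m,k)$, and with probability $(n-k)/n$, at board state $(m,n-k)$. Let $P(n,m)$ denote the probability that the player to move at $(n,m)$ wins when both players play optimally; it is determined (by induction on $n+m$) by $$P(n,m)=\max\Big(\tfrac1n,\ \max_{1\le k\le n/2}\Big(1-\tfrac{k}{n}P(m,k)-\tfrac{n-k}{n}P(m,n-k)\Big)\Big),$$ where the inner maximum is omitted when $n=1$ (so $P(1,m)=1$). A decision at $(n,m)$ is optimal if it attains this maximum (the guess attaining $1/n$, or $k$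 attaining the corresponding value). -}

module Defs where

open import Data.Nat using (ℕ; zero; suc; _+_; _∸_; _≤_; _≡ᵇ_)
open import Data.Nat.DivMod using (_/_)
open import Data.Integer using (+_)
open import Data.Rational using (ℚ; 0ℚ; 1ℚ; _*_; _-_; _⊔_) renaming (_/_ to _÷_)
open import Data.List using (List; []; _∷_; map; foldr; upTo)
open import Data.Bool using (if_then_else_; _∨_; _∧_)
open import Data.Product using (_×_)
open import Data.Sum using (_⊎_)
open import Relation.Binary.PropositionalEquality using (_≡_)

-- The rational number a/n (a, n natural); the n = 0 case never arises in use.
frac : ℕ → ℕ → ℚ
frac a zero    = 0ℚ
frac a (suc n) = (+ a) ÷ suc n

range1 : ℕ → List ℕ
range1 j = map suc (upTo j)

-- With fuel f ≥ n + m every recursive call has enough fuel (m + k < n + m and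
-- m + (n - k) < n + m for 1 ≤ k ≤ n/2), so Pf (n + m) n m is exactly P(n,m).
Pf : ℕ → ℕ → ℕ → ℚ
Pf zero    n m = 0ℚ
Pf (suc f) n m =
  foldr _⊔_ (frac 1 n)
    (map (λ k → 1ℚ - frac k n * Pf f m k - frac (n ∸ k) n * Pf f m (n ∸ k))
         (range1 (n / 2)))

-- P(n,m): winning probability of the player to move at board state (n,m)
-- under optimal play.  P(n,m) = max(1/n, max_{1≤k≤n/2} (1 - k/n P(m,k) - (n-k)/n P(m,n-k))).
P : ℕ → ℕ → ℚ
P n m = Pf (n + m) n m

-- Value (winning probability for the mover) of decision d at board state (n,m),
-- given optimal play afterwards: d = 0 is the guess, d = k ≥ 1 is the question of size k.
value : ℕ → ℕ → ℕ → ℚ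
value n m zero    = frac 1 n
value n m (suc j) = 1ℚ - frac k n * P m k - frac (n ∸ k) n * P m (n ∸ k)
  where k = suc j

Legal : ℕ → ℕ → Set
Legal n d = d ≡ 0 ⊎ (1 ≤ d × d ≤ n / 2)

Optimal : ℕ → ℕ → ℕ → Set
Optimal n m d = Legal n d × value n m d ≡ P n m

nLess : ℕ → ℕ
nLess n = if n ≡ᵇ 2 then 1 else (n / 4 + (n + 1) / 4)

S : ℕ → ℕ → ℕ
S n m =
  if (n ≡ᵇ 1) ∨ (m ≡ᵇ 1) then 0 else
  if (n ≡ᵇ 4) ∧ (m ≡ᵇ 4) then 1 else
  if (n ≡ᵇ 6) ∧ (m ≡ᵇ 4) then 3 else
  if (n ≡ᵇ 10) ∧ (m ≡ᵇ 4) then 5 else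
  nLess n

{-# OPTIONS --safe #-}

-- Multiplying by n m, P(n,m) = W n m / (n m) for an integer W with
-- W n m = max (m , max_k (L m k + L m (n - k))), where L m k = m k - W m k.
-- By induction on n + m we prove at the same time that the question k = n_< attains this
-- maximum and that every L m is concave in steps of three:
-- L m k + L m (k + 3) ≤ L m (k + 1) + L m (k + 2).  This concavity pushes the maximum of
-- L m k + L m (n - k) to the central questions, and for even n the choice between the two
-- central ones is settled by a midpoint inequality for L m.  Both kinds of inequality for
-- L m are inherited from the same inequalities for j ↦ W j a and j ↦ W j b, where (a , b)
-- is the n_< split of m: since L m j + W m j = m j = (L j a + W j a) + (L j b + W j b),
-- L m j ≤ W j a + W j b, with equality when (a , b) is optimal at (m , j).  The
-- inequalities for W j x follow from the explicit optimal splits known by induction.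
-- The finitely many boards where this argument does not apply, among them the exceptional
-- boards (4,4), (6,4) and (10,4), are settled by evaluation.
module Submission where

open import Defs
open import Data.Nat using (ℕ; zero; suc; _+_; _*_; _∸_; _≤_; _<_; _⊔_; _≤′_; ≤′-refl; ≤′-step; z≤n; s≤s; z<s; _≟_; _≤?_; _≡ᵇ_; _≤ᵇ_)
open import Data.Nat.Properties
open import Data.Nat.DivMod using (_/_; m/n*n≤m; m*n/n≡m; /-monoˡ-≤; +-distrib-/-∣ʳ)
open import Data.Nat.Divisibility using (n∣m*n)
open import Data.Nat.Tactic.RingSolver using (solve-∀)
open import Algebra.Properties.CommutativeSemigroup +-commutativeSemigroup using (interchange)
import Data.Integer as ℤ
import Data.Integer.Properties as ℤP
open import Data.Rational as ℚ using (0ℚ; 1ℚ; toℚᵘ)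
import Data.Rational.Properties as ℚP
open import Data.Rational.Unnormalised as ℚᵘ using (mkℚᵘ; *≡*; *≤*; _≃_)
import Data.Rational.Unnormalised.Properties as ℚᵘP
open import Data.Rational.Solver using (module +-*-Solver)
open import Data.Bool using (T; true; false)
open import Data.Bool.Properties using (∧-zeroʳ; ∨-zeroʳ)
open import Data.List using ([]; _∷_; map; foldr)
open import Data.List.Properties using (map-cong-local; foldr-preservesᵇ; foldr-preservesᵒ)
open import Data.List.Relation.Unary.All as All using ()
open import Data.List.Relation.Unary.All.Properties using () renaming (map⁺ to All-map⁺)
open import Data.List.Relation.Unary.Any as Any using ()
open import Data.List.Membership.Propositional using (_∈_)
open import Data.List.Membership.Propositional.Properties using (∈-map⁻; ∈-map⁺; ∈-upTo⁺; ∈-upTo⁻; foldr-selective)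
open import Data.Product using (_×_; _,_; proj₁; proj₂; uncurry)
open import Data.Sum using (_⊎_; inj₁; inj₂; [_,_])
open import Function using (_∘_)
open import Relation.Binary.PropositionalEquality hiding ([_])
open import Relation.Nullary using (¬_; Dec; yes; no; contradiction)
open import Relation.Nullary.Decidable using (_×-dec_; _⊎-dec_; dec-false)

k≤n/2⇒k+k≤n : ∀ {k n} → k ≤ n / 2 → k + k ≤ n
k≤n/2⇒k+k≤n {k} {n} k≤ = begin
  k + k      ≡⟨ cong (k +_) (sym (+-identityʳ k)) ⟩
  2 * k      ≡⟨ *-comm 2 k ⟩
  k * 2      ≤⟨ *-monoˡ-≤ 2 k≤ ⟩
  n / 2 * 2  ≤⟨ m/n*n≤m n 2 ⟩
  n          ∎
  where open ≤-Reasoning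

k+k≤n⇒k≤n/2 : ∀ {k n} → k + k ≤ n → k ≤ n / 2
k+k≤n⇒k≤n/2 {k} {n} le = begin
  k                  ≡⟨ sym (m*n/n≡m k 2) ⟩
  k * 2 / 2          ≡⟨ cong (_/ 2) (*-comm k 2) ⟩
  (k + (k + 0)) / 2  ≡⟨ cong (λ x → (k + x) / 2) (+-identityʳ k) ⟩
  (k + k) / 2        ≤⟨ /-monoˡ-≤ 2 le ⟩
  n / 2              ∎
  where open ≤-Reasoning

∈-range1[n/2]⁻ : ∀ {n k} → k ∈ range1 (n / 2) → 1 ≤ k × k + k ≤ n
∈-range1[n/2]⁻ k∈ with ∈-map⁻ suc k∈
... | _ , i∈ , refl = z<s , k≤n/2⇒k+k≤n (∈-upTo⁻ i∈)

∈-range1[n/2]⁺ : ∀ {n k} → 1 ≤ k → k + k ≤ n → k ∈ range1 (n / 2)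
∈-range1[n/2]⁺ {k = suc _} _ k+k≤n = ∈-map⁺ suc (∈-upTo⁺ (k+k≤n⇒k≤n/2 k+k≤n))

part<whole : ∀ {k n} → 1 ≤ k → k + k ≤ n → k < n × n ∸ k < n
part<whole {suc k} {suc n} 1≤k k+k≤n = ≤-trans (m<m+n (suc k) 1≤k) k+k≤n , s≤s (m∸n≤m n k)

-- The integer recursion

-- W n m = n m P(n,m) is the number of the n m equally likely pairs of mystery persons for
-- which the player to move at (n,m) wins, computed with the same fuel as Pf; L m k counts
-- the pairs at (m,k) won by the opponent of the player to move.
Wf : ℕ → ℕ → ℕ → ℕ
Wf zero    n m = 0
Wf (suc f) n m =
  foldr _⊔_ m (map (λ k → (m * k ∸ Wf f m k) + (m * (n ∸ k) ∸ Wf f m (n ∸ k))) (range1 (n / 2)))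

W : ℕ → ℕ → ℕ
W n m = Wf (n + m) n m

L : ℕ → ℕ → ℕ
L m k = m * k ∸ W m k

splitValue : ℕ → ℕ → ℕ → ℕ
splitValue n m k = L m k + L m (n ∸ k)

Wf-fuel-irrelevant : ∀ f g n m → n + m ≤ f → n + m ≤ g → Wf f n m ≡ Wf g n m
Wf-fuel-irrelevant zero    zero    n       m       _  _  = refl
Wf-fuel-irrelevant zero    (suc g) zero    zero    _  _  = refl
Wf-fuel-irrelevant (suc f) zero    zero    zero    _  _  = refl
Wf-fuel-irrelevant (suc f) (suc g) n       m       ≤f ≤g =
  cong (foldr _⊔_ m) (map-cong-local (All.tabulate same-split))
  where
  fuel : ∀ {h i} → i < n → n + m ≤ suc h → m + i ≤ h
  fuel {i = i} i<n ≤h = ≤-pred (≤-trans (s≤s (≤-reflexive (+-comm m i))) (≤-trans (+-monoˡ-≤ m i<n) ≤h))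
  same-split : ∀ {k} → k ∈ range1 (n / 2) →
    (m * k ∸ Wf f m k) + (m * (n ∸ k) ∸ Wf f m (n ∸ k)) ≡ (m * k ∸ Wf g m k) + (m * (n ∸ k) ∸ Wf g m (n ∸ k))
  same-split {k} k∈ with ∈-range1[n/2]⁻ {n} k∈
  ... | 1≤k , k+k≤n with part<whole 1≤k k+k≤n
  ...   | k<n , n∸k<n =
    cong₂ _+_ (cong (m * k ∸_) (Wf-fuel-irrelevant f g m k (fuel k<n ≤f) (fuel k<n ≤g)))
              (cong (m * (n ∸ k) ∸_) (Wf-fuel-irrelevant f g m (n ∸ k) (fuel n∸k<n ≤f) (fuel n∸k<n ≤g)))

W-unfold : ∀ n m → W n m ≡ foldr _⊔_ m (map (splitValue n m) (range1 (n / 2)))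
W-unfold zero    zero    = refl
W-unfold zero    (suc m) = refl
W-unfold (suc n) m = cong (foldr _⊔_ m) (map-cong-local (All.tabulate stable))
  where
  stable : ∀ {k} → k ∈ range1 (suc n / 2) →
           (m * k ∸ Wf (n + m) m k) + (m * (suc n ∸ k) ∸ Wf (n + m) m (suc n ∸ k)) ≡ splitValue (suc n) m k
  stable {k} k∈ with ∈-range1[n/2]⁻ {suc n} k∈
  ... | 1≤k , k+k≤n with part<whole 1≤k k+k≤n
  ...   | k<n , n∸k<n =
    cong₂ _+_ (cong (m * k ∸_) (Wf-fuel-irrelevant _ _ m _ (fuel k<n) ≤-refl))
              (cong (m * (suc n ∸ k) ∸_) (Wf-fuel-irrelevant _ _ m _ (fuel n∸k<n) ≤-refl))
    where
    fuel : ∀ {i} → i < suc n → m + i ≤ n + m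
    fuel {i} i<n = ≤-trans (≤-reflexive (+-comm m i)) (+-monoˡ-≤ m (≤-pred i<n))

m≤n⊎m≤o⇒m≤n⊔o : ∀ {v} x y → v ≤ x ⊎ v ≤ y → v ≤ x ⊔ y
m≤n⊎m≤o⇒m≤n⊔o x y = [ m≤n⇒m≤n⊔o y , m≤n⇒m≤o⊔n x ]

m≤W : ∀ n m → m ≤ W n m
m≤W n m rewrite W-unfold n m = foldr-preservesᵒ {P = m ≤_} m≤n⊎m≤o⇒m≤n⊔o m (map (splitValue n m) (range1 (n / 2))) (inj₁ ≤-refl)

splitValue≤W : ∀ {n m k} → 1 ≤ k → k + k ≤ n → splitValue n m k ≤ W n m
splitValue≤W {n} {m} {k} 1≤k k+k≤n rewrite W-unfold n m =
  foldr-preservesᵒ {P = splitValue n m k ≤_} m≤n⊎m≤o⇒m≤n⊔o m _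
    (inj₂ (Any.map ≤-reflexive (∈-map⁺ (splitValue n m) (∈-range1[n/2]⁺ 1≤k k+k≤n))))

L+L≤W : ∀ {m n} i j → i + j ≡ n → 1 ≤ i → 1 ≤ j → L m i + L m j ≤ W n m
L+L≤W {m} {n} i j refl 1≤i 1≤j with ≤-total i j
... | inj₁ i≤j = begin
  L m i + L m j                ≡⟨ cong (λ x → L m i + L m x) (sym (m+n∸m≡n i j)) ⟩
  splitValue (i + j) m i       ≤⟨ splitValue≤W 1≤i (+-monoʳ-≤ i i≤j) ⟩
  W (i + j) m                  ∎
  where open ≤-Reasoning
... | inj₂ j≤i = begin
  L m i + L m j                ≡⟨ +-comm (L m i) (L m j) ⟩
  L m j + L m i                ≡⟨ cong (λ x → L m j + L m x) (sym (m+n∸n≡m i j)) ⟩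
  splitValue (i + j) m j       ≤⟨ splitValue≤W 1≤j (≤-trans (+-monoʳ-≤ j j≤i) (≤-reflexive (+-comm j i))) ⟩
  W (i + j) m                  ∎
  where open ≤-Reasoning

W-elim : ∀ (P : ℕ → Set) {n m} → P m → (∀ {k} → 1 ≤ k → k + k ≤ n → P (splitValue n m k)) → P (W n m)
W-elim P {n} {m} base step rewrite W-unfold n m with foldr-selective ⊔-sel m (map (splitValue n m) (range1 (n / 2)))
... | inj₁ ≡m = subst P (sym ≡m) base
... | inj₂ ∈xs with ∈-map⁻ (splitValue n m) ∈xs
...   | k , k∈ , ≡v = subst P (sym ≡v) (step (proj₁ (∈-range1[n/2]⁻ {n} k∈)) (proj₂ (∈-range1[n/2]⁻ {n} k∈)))

Wf≤n*m : ∀ f {n m} → 1 ≤ n → Wf f n m ≤ n * m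
Wf≤n*m zero    _ = z≤n
Wf≤n*m (suc f) {n} {m} 1≤n =
  foldr-preservesᵇ {P = _≤ n * m} ⊔-lub (≤-trans (≤-reflexive (sym (*-identityˡ m))) (*-monoˡ-≤ m 1≤n))
                                        (All-map⁺ (All.tabulate bound))
  where
  bound : ∀ {k} → k ∈ range1 (n / 2) → (m * k ∸ Wf f m k) + (m * (n ∸ k) ∸ Wf f m (n ∸ k)) ≤ n * m
  bound {k} k∈ = begin
    (m * k ∸ Wf f m k) + (m * (n ∸ k) ∸ Wf f m (n ∸ k))
      ≤⟨ +-mono-≤ (m∸n≤m (m * k) (Wf f m k)) (m∸n≤m (m * (n ∸ k)) (Wf f m (n ∸ k))) ⟩
    m * k + m * (n ∸ k)  ≡⟨ sym (*-distribˡ-+ m k (n ∸ k)) ⟩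
    m * (k + (n ∸ k))    ≡⟨ cong (m *_) (m+[n∸m]≡n k≤n) ⟩
    m * n                ≡⟨ *-comm m n ⟩
    n * m                ∎
    where
    open ≤-Reasoning
    k≤n = <⇒≤ (proj₁ (uncurry part<whole (∈-range1[n/2]⁻ {n} k∈)))

W≤n*m : ∀ {n m} → 1 ≤ n → W n m ≤ n * m
W≤n*m {n} {m} = Wf≤n*m (n + m)

L+W≡m*k : ∀ {m k} → 1 ≤ m → L m k + W m k ≡ m * k
L+W≡m*k 1≤m = m∸n+n≡m (W≤n*m 1≤m)

L[1,k]≡0 : ∀ k → L 1 k ≡ 0
L[1,k]≡0 k = trans (cong (_∸ k) (+-identityʳ k)) (n∸n≡0 k)

W[n,1]≡1 : ∀ {n} → W n 1 ≡ 1
W[n,1]≡1 {n} = ≤-antisym (W-elim (_≤ 1) ≤-refl no-loss) (m≤W n 1)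
  where
  no-loss : ∀ {k} → 1 ≤ k → k + k ≤ n → splitValue n 1 k ≤ 1
  no-loss {k} _ _ rewrite L[1,k]≡0 k | L[1,k]≡0 (n ∸ k) = z≤n

1+L[m,1]≡m : ∀ {m} → 1 ≤ m → suc (L m 1) ≡ m
1+L[m,1]≡m {m} 1≤m = begin
  suc (L m 1)        ≡⟨ +-comm 1 (L m 1) ⟩
  L m 1 + 1          ≡⟨ cong (L m 1 +_) (sym (W[n,1]≡1 {m})) ⟩
  L m 1 + W m 1      ≡⟨ L+W≡m*k 1≤m ⟩
  m * 1              ≡⟨ *-identityʳ m ⟩
  m                  ∎
  where open ≡-Reasoning

L+k≤m*k : ∀ {m k} → 1 ≤ m → L m k + k ≤ m * k
L+k≤m*k {m} {k} 1≤m = ≤-trans (+-monoʳ-≤ (L m k) (m≤W m k)) (≤-reflexive (L+W≡m*k 1≤m))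

W[m,j]+m≤m*j+1 : ∀ {m j} → 1 ≤ m → 1 ≤ j → W m j + m ≤ m * j + 1
W[m,j]+m≤m*j+1 {m} {j} 1≤m 1≤j = W-elim (λ w → w + m ≤ m * j + 1) (guess m j 1≤m 1≤j) question
  where
  guess : ∀ m j → 1 ≤ m → 1 ≤ j → j + m ≤ m * j + 1
  guess (suc m) (suc j) _ _ = begin
    suc j + suc m            ≡⟨ cong (suc j +_) (+-comm 1 m) ⟩
    suc j + (m + 1)          ≤⟨ +-monoʳ-≤ (suc j) (+-monoˡ-≤ 1 (m≤m*n m (suc j))) ⟩
    suc j + (m * suc j + 1)  ≡⟨ sym (+-assoc (suc j) (m * suc j) 1) ⟩
    suc m * suc j + 1        ∎
    where open ≤-Reasoning
  question : ∀ {k} → 1 ≤ k → k + k ≤ m → splitValue m j k + m ≤ m * j + 1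
  question {k} _ k+k≤m = begin
    L j k + L j (m ∸ k) + m                    ≡⟨ cong (L j k + L j (m ∸ k) +_) (sym (m+[n∸m]≡n k≤m)) ⟩
    L j k + L j (m ∸ k) + (k + (m ∸ k))        ≡⟨ interchange (L j k) (L j (m ∸ k)) k (m ∸ k) ⟩
    (L j k + k) + (L j (m ∸ k) + (m ∸ k))      ≤⟨ +-mono-≤ (L+k≤m*k 1≤j) (L+k≤m*k 1≤j) ⟩
    j * k + j * (m ∸ k)                        ≡⟨ sym (*-distribˡ-+ j k (m ∸ k)) ⟩
    j * (k + (m ∸ k))                          ≡⟨ cong (j *_) (m+[n∸m]≡n k≤m) ⟩
    j * m                                      ≡⟨ *-comm j m ⟩
    m * j                                      ≤⟨ m≤m+n (m * j) 1 ⟩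
    m * j + 1                                  ∎
    where
    open ≤-Reasoning
    k≤m = ≤-trans (m≤m+n k k) k+k≤m

m≤1+L[m,j] : ∀ {m j} → 1 ≤ m → 1 ≤ j → m ≤ suc (L m j)
m≤1+L[m,j] {m} {j} 1≤m 1≤j = +-cancelˡ-≤ (W m j) m (suc (L m j)) (begin
  W m j + m               ≤⟨ W[m,j]+m≤m*j+1 1≤m 1≤j ⟩
  m * j + 1               ≡⟨ cong (_+ 1) (sym (L+W≡m*k 1≤m)) ⟩
  L m j + W m j + 1       ≡⟨ +-comm (L m j + W m j) 1 ⟩
  suc (L m j + W m j)     ≡⟨ cong suc (+-comm (L m j) (W m j)) ⟩
  suc (W m j + L m j)     ≡⟨ sym (+-suc (W m j) (L m j)) ⟩
  W m j + suc (L m j)     ∎)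
  where open ≤-Reasoning

W≡best-split : ∀ {n m s} → 2 ≤ m → 1 ≤ s → s + s ≤ n →
  (∀ {k} → 1 ≤ k → k + k ≤ n → splitValue n m k ≤ splitValue n m s) → W n m ≡ splitValue n m s
W≡best-split {n} {m} {s} 2≤m 1≤s s+s≤n best =
  ≤-antisym (W-elim (_≤ splitValue n m s) guess≤ best) (splitValue≤W 1≤s s+s≤n)
  where
  1≤m = ≤-trans (s≤s z≤n) 2≤m
  s<n = proj₁ (part<whole 1≤s s+s≤n)
  1≤L : 1 ≤ L m (n ∸ s)
  1≤L = ≤-pred (≤-trans 2≤m (m≤1+L[m,j] 1≤m (m<n⇒0<n∸m s<n)))
  guess≤ : m ≤ splitValue n m s
  guess≤ = ≤-trans (m≤1+L[m,j] 1≤m 1≤s) (≤-trans (≤-reflexive (+-comm 1 (L m s))) (+-monoʳ-≤ (L m s) 1≤L))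

W[2,m]≡L+L : ∀ {m} → 2 ≤ m → W 2 m ≡ L m 1 + L m 1
W[2,m]≡L+L {m} 2≤m = W≡best-split 2≤m z<s ≤-refl only-split
  where
  only-split : ∀ {k} → 1 ≤ k → k + k ≤ 2 → splitValue 2 m k ≤ splitValue 2 m 1
  only-split {1} _ _ = ≤-refl
  only-split {suc (suc k)} _ k+k≤2 = contradiction (≤-trans (+-mono-≤ (m≤m+n 2 k) (m≤m+n 2 k)) k+k≤2) λ { (s≤s (s≤s ())) }

2≤L[2,j] : ∀ {j} → 2 ≤ j → 2 ≤ L 2 j
2≤L[2,j] {j} 2≤j = +-cancelˡ-≤ (W 2 j) 2 (L 2 j) (begin
  W 2 j + 2                          ≡⟨ cong (_+ 2) (W[2,m]≡L+L 2≤j) ⟩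
  L j 1 + L j 1 + 2                  ≡⟨ regroup (L j 1) ⟩
  suc (L j 1) + (suc (L j 1) + 0)    ≡⟨ cong (λ x → x + (x + 0)) (1+L[m,1]≡m (≤-trans (s≤s z≤n) 2≤j)) ⟩
  2 * j                              ≡⟨ sym (L+W≡m*k {2} {j} z<s) ⟩
  L 2 j + W 2 j                      ≡⟨ +-comm (L 2 j) (W 2 j) ⟩
  W 2 j + L 2 j                      ∎)
  where
  open ≤-Reasoning
  regroup : ∀ l → l + l + 2 ≡ suc l + (suc l + 0)
  regroup = solve-∀

x+L[x,2]≤3L[x,1] : ∀ {x} → 3 ≤ x → x + L x 2 ≤ L x 1 + (L x 1 + L x 1)
x+L[x,2]≤3L[x,1] {x} 3≤x = +-cancelʳ-≤ 3 _ _ (begin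
  (x + L x 2) + 3                      ≤⟨ +-monoʳ-≤ (x + L x 2) 3≤W ⟩
  (x + L x 2) + W x 2                  ≡⟨ +-assoc x (L x 2) (W x 2) ⟩
  x + (L x 2 + W x 2)                  ≡⟨ cong (x +_) (L+W≡m*k 1≤x) ⟩
  x + x * 2                            ≡⟨ cong (λ y → y + y * 2) (sym (1+L[m,1]≡m 1≤x)) ⟩
  suc (L x 1) + suc (L x 1) * 2        ≡⟨ regroup (L x 1) ⟩
  L x 1 + (L x 1 + L x 1) + 3          ∎)
  where
  open ≤-Reasoning
  1≤x = ≤-trans (s≤s z≤n) 3≤x
  3≤W : 3 ≤ W x 2
  3≤W = ≤-trans (+-monoʳ-≤ 1 (2≤L[2,j] (∸-monoˡ-≤ 1 3≤x)))
                (L+L≤W 1 (x ∸ 1) (m+[n∸m]≡n 1≤x) ≤-refl (∸-monoˡ-≤ 1 (≤-trans (n≤1+n 2) 3≤x)))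
  regroup : ∀ l → suc l + suc l * 2 ≡ l + (l + l) + 3
  regroup = solve-∀

-- From P to W

toℚᵘ-frac : ∀ a d → toℚᵘ (frac a (suc d)) ≃ mkℚᵘ (ℤ.+ a) d
toℚᵘ-frac a d = ℚP.toℚᵘ-fromℚᵘ (mkℚᵘ (ℤ.+ a) d)

frac-cross : ∀ a b d e → a * suc e ≡ b * suc d → frac a (suc d) ≡ frac b (suc e)
frac-cross a b d e eq = ℚP.toℚᵘ-injective (begin
  toℚᵘ (frac a (suc d))  ≈⟨ toℚᵘ-frac a d ⟩
  mkℚᵘ (ℤ.+ a) d         ≈⟨ *≡* (trans (sym (ℤP.pos-* a (suc e))) (trans (cong ℤ.+_ eq) (ℤP.pos-* b (suc d)))) ⟩
  mkℚᵘ (ℤ.+ b) e         ≈⟨ ℚᵘP.≃-sym (toℚᵘ-frac b e) ⟩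
  toℚᵘ (frac b (suc e))  ∎)
  where open ℚᵘP.≃-Reasoning

-- ℚᵘ arithmetic computes on mkℚᵘ, so only the casts from ℕ to ℤ need rewriting.
frac-* : ∀ a b d e → frac a (suc d) ℚ.* frac b (suc e) ≡ frac (a * b) (suc d * suc e)
frac-* a b d e = ℚP.toℚᵘ-injective (begin
  toℚᵘ (frac a (suc d) ℚ.* frac b (suc e))          ≈⟨ ℚP.toℚᵘ-homo-* (frac a (suc d)) (frac b (suc e)) ⟩
  toℚᵘ (frac a (suc d)) ℚᵘ.* toℚᵘ (frac b (suc e))  ≈⟨ ℚᵘP.*-cong (toℚᵘ-frac a d) (toℚᵘ-frac b e) ⟩
  mkℚᵘ (ℤ.+ a) d ℚᵘ.* mkℚᵘ (ℤ.+ b) e                ≈⟨ ℚᵘP.≃-reflexive (cong (λ z → mkℚᵘ z _) (sym (ℤP.pos-* a b))) ⟩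
  mkℚᵘ (ℤ.+ (a * b)) (e + d * suc e)                ≈⟨ ℚᵘP.≃-sym (toℚᵘ-frac (a * b) _) ⟩
  toℚᵘ (frac (a * b) (suc d * suc e))               ∎)
  where open ℚᵘP.≃-Reasoning

frac-+ : ∀ a b d e → frac a (suc d) ℚ.+ frac b (suc e) ≡ frac (a * suc e + b * suc d) (suc d * suc e)
frac-+ a b d e = ℚP.toℚᵘ-injective (begin
  toℚᵘ (frac a (suc d) ℚ.+ frac b (suc e))            ≈⟨ ℚP.toℚᵘ-homo-+ (frac a (suc d)) (frac b (suc e)) ⟩
  toℚᵘ (frac a (suc d)) ℚᵘ.+ toℚᵘ (frac b (suc e))    ≈⟨ ℚᵘP.+-cong (toℚᵘ-frac a d) (toℚᵘ-frac b e) ⟩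
  mkℚᵘ (ℤ.+ a) d ℚᵘ.+ mkℚᵘ (ℤ.+ b) e                  ≈⟨ ℚᵘP.≃-reflexive (cong (λ z → mkℚᵘ z _) numerator) ⟩
  mkℚᵘ (ℤ.+ (a * suc e + b * suc d)) (e + d * suc e)  ≈⟨ ℚᵘP.≃-sym (toℚᵘ-frac _ _) ⟩
  toℚᵘ (frac (a * suc e + b * suc d) (suc d * suc e)) ∎)
  where
  open ℚᵘP.≃-Reasoning
  numerator : ℤ.+ a ℤ.* ℤ.+ suc e ℤ.+ ℤ.+ b ℤ.* ℤ.+ suc d ≡ ℤ.+ (a * suc e + b * suc d)
  numerator = trans (cong₂ ℤ._+_ (sym (ℤP.pos-* a (suc e))) (sym (ℤP.pos-* b (suc d))))
                    (sym (ℤP.pos-+ (a * suc e) (b * suc d)))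

frac-+-same : ∀ a b d → frac a (suc d) ℚ.+ frac b (suc d) ≡ frac (a + b) (suc d)
frac-+-same a b d = trans (frac-+ a b d d) (frac-cross (a * suc d + b * suc d) (a + b) (d + d * suc d) d (eq a b (suc d)))
  where
  eq : ∀ a b D → (a * D + b * D) * D ≡ (a + b) * (D * D)
  eq = solve-∀

frac-self : ∀ d → frac (suc d) (suc d) ≡ 1ℚ
frac-self d = frac-cross (suc d) 1 d 0 (*-comm (suc d) 1)

frac-*-cancel : ∀ k n m w → frac (suc k) (suc n) ℚ.* frac w (suc m * suc k) ≡ frac w (suc n * suc m)
frac-*-cancel k n m w =
  trans (frac-* (suc k) w n (k + m * suc k))
        (frac-cross (suc k * w) w _ _ (eq (suc k) w (suc n) (suc m)))
  where
  eq : ∀ k w n m → k * w * (n * m) ≡ w * (n * (m * k))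
  eq = solve-∀

1-frac-frac : ∀ {a b c N} → c + a + b ≡ suc N → 1ℚ ℚ.- frac a (suc N) ℚ.- frac b (suc N) ≡ frac c (suc N)
1-frac-frac {a} {b} {c} {N} eq = begin
  1ℚ ℚ.- x ℚ.- y                                  ≡⟨ cong (λ z → z ℚ.- x ℚ.- y) one ⟩
  (frac c (suc N) ℚ.+ x ℚ.+ y) ℚ.- x ℚ.- y        ≡⟨ cancel (frac c (suc N)) x y ⟩
  frac c (suc N)                                  ∎
  where
  open ≡-Reasoning
  open +-*-Solver
  x = frac a (suc N)
  y = frac b (suc N)
  one : 1ℚ ≡ frac c (suc N) ℚ.+ x ℚ.+ y
  one = begin
    1ℚ                                            ≡⟨ sym (frac-self N) ⟩
    frac (suc N) (suc N)                          ≡⟨ cong (λ z → frac z (suc N)) (sym eq) ⟩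
    frac (c + a + b) (suc N)                      ≡⟨ sym (frac-+-same (c + a) b N) ⟩
    frac (c + a) (suc N) ℚ.+ y                    ≡⟨ cong (ℚ._+ y) (sym (frac-+-same c a N)) ⟩
    frac c (suc N) ℚ.+ x ℚ.+ y                    ∎
  cancel : ∀ p q r → (p ℚ.+ q ℚ.+ r) ℚ.- q ℚ.- r ≡ p
  cancel = solve 3 (λ p q r → (p :+ q :+ r) :- q :- r := p) refl

question-value : ∀ {n m k K w₁ w₂} → k + K ≡ n → 1 ≤ k → 1 ≤ K → 1 ≤ m → w₁ ≤ m * k → w₂ ≤ m * K →
  1ℚ ℚ.- frac k n ℚ.* frac w₁ (m * k) ℚ.- frac K n ℚ.* frac w₂ (m * K)
    ≡ frac ((m * k ∸ w₁) + (m * K ∸ w₂)) (n * m)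
question-value {suc n} {suc m} {suc k} {suc K} {w₁} {w₂} eq _ _ _ w₁≤ w₂≤ =
  trans (cong₂ (λ x y → 1ℚ ℚ.- x ℚ.- y) (frac-*-cancel k n m w₁) (frac-*-cancel K n m w₂))
        (1-frac-frac {w₁} {w₂} total)
  where
  M = suc m
  total : (M * suc k ∸ w₁) + (M * suc K ∸ w₂) + w₁ + w₂ ≡ suc n * M
  total = begin
    (M * suc k ∸ w₁) + (M * suc K ∸ w₂) + w₁ + w₂       ≡⟨ regroup (M * suc k ∸ w₁) (M * suc K ∸ w₂) w₁ w₂ ⟩
    (M * suc k ∸ w₁ + w₁) + (M * suc K ∸ w₂ + w₂)       ≡⟨ cong₂ _+_ (m∸n+n≡m w₁≤) (m∸n+n≡m w₂≤) ⟩
    M * suc k + M * suc K                               ≡⟨ sym (*-distribˡ-+ M (suc k) (suc K)) ⟩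
    M * (suc k + suc K)                                 ≡⟨ cong (M *_) eq ⟩
    M * suc n                                           ≡⟨ *-comm M (suc n) ⟩
    suc n * M                                           ∎
    where
    open ≡-Reasoning
    regroup : ∀ a b c d → a + b + c + d ≡ (a + c) + (b + d)
    regroup = solve-∀

frac-mono-≤ : ∀ {a b} d → a ≤ b → frac a (suc d) ℚ.≤ frac b (suc d)
frac-mono-≤ {a} {b} d a≤b = ℚP.toℚᵘ-cancel-≤ (ℚᵘP.≤-respˡ-≃ (ℚᵘP.≃-sym (toℚᵘ-frac a d))
                                            (ℚᵘP.≤-respʳ-≃ (ℚᵘP.≃-sym (toℚᵘ-frac b d)) (*≤* cross)))
  where
  cross : ℤ.+ a ℤ.* ℤ.+ suc d ℤ.≤ ℤ.+ b ℤ.* ℤ.+ suc d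
  cross = subst₂ ℤ._≤_ (ℤP.pos-* a (suc d)) (ℤP.pos-* b (suc d)) (ℤ.+≤+ (*-monoˡ-≤ (suc d) a≤b))

frac-⊔ : ∀ a b d → frac a (suc d) ℚ.⊔ frac b (suc d) ≡ frac (a ⊔ b) (suc d)
frac-⊔ a b d with ≤-total a b
... | inj₁ a≤b = trans (ℚP.p≤q⇒p⊔q≡q (frac-mono-≤ d a≤b)) (cong (λ z → frac z (suc d)) (sym (m≤n⇒m⊔n≡n a≤b)))
... | inj₂ b≤a = trans (ℚP.p≥q⇒p⊔q≡p (frac-mono-≤ d b≤a)) (cong (λ z → frac z (suc d)) (sym (m≥n⇒m⊔n≡m b≤a)))

frac-0 : ∀ d → frac 0 (suc d) ≡ 0ℚ
frac-0 d = frac-cross 0 0 d 0 refl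

frac-1 : ∀ n m → frac 1 (suc n) ≡ frac (suc m) (suc n * suc m)
frac-1 n m = frac-cross 1 (suc m) n _ (trans (*-identityˡ _) (*-comm (suc n) (suc m)))

foldr-⊔-frac : ∀ (h : ℕ → ℕ) b d xs →
  foldr ℚ._⊔_ (frac b (suc d)) (map (λ k → frac (h k) (suc d)) xs) ≡ frac (foldr _⊔_ b (map h xs)) (suc d)
foldr-⊔-frac h b d []       = refl
foldr-⊔-frac h b d (x ∷ xs) =
  trans (cong (frac (h x) (suc d) ℚ.⊔_) (foldr-⊔-frac h b d xs)) (frac-⊔ (h x) (foldr _⊔_ b (map h xs)) d)

Pf≡frac-Wf : ∀ f {n m} → 1 ≤ n → 1 ≤ m → Pf f n m ≡ frac (Wf f n m) (n * m)
Pf≡frac-Wf zero    {suc n} {suc m} _ _ = sym (frac-0 (m + n * suc m))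
Pf≡frac-Wf (suc f) {suc n} {suc m} _ _ = begin
  Pf (suc f) (suc n) (suc m)
    ≡⟨ cong (foldr ℚ._⊔_ (frac 1 (suc n))) (map-cong-local (All.tabulate question)) ⟩
  foldr ℚ._⊔_ (frac 1 (suc n)) (map (λ k → frac (h k) (suc n * suc m)) (range1 (suc n / 2)))
    ≡⟨ cong (λ z → foldr ℚ._⊔_ z (map (λ k → frac (h k) (suc n * suc m)) (range1 (suc n / 2)))) (frac-1 n m) ⟩
  foldr ℚ._⊔_ (frac (suc m) (suc n * suc m)) (map (λ k → frac (h k) (suc n * suc m)) (range1 (suc n / 2)))
    ≡⟨ foldr-⊔-frac h (suc m) _ (range1 (suc n / 2)) ⟩
  frac (Wf (suc f) (suc n) (suc m)) (suc n * suc m) ∎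
  where
  open ≡-Reasoning
  h : ℕ → ℕ
  h k = (suc m * k ∸ Wf f (suc m) k) + (suc m * (suc n ∸ k) ∸ Wf f (suc m) (suc n ∸ k))
  question : ∀ {k} → k ∈ range1 (suc n / 2) →
    1ℚ ℚ.- frac k (suc n) ℚ.* Pf f (suc m) k ℚ.- frac (suc n ∸ k) (suc n) ℚ.* Pf f (suc m) (suc n ∸ k)
      ≡ frac (h k) (suc n * suc m)
  question {k} k∈ with ∈-range1[n/2]⁻ {suc n} k∈
  ... | 1≤k , k+k≤n with part<whole 1≤k k+k≤n
  ...   | k<n , _ = begin
    1ℚ ℚ.- frac k (suc n) ℚ.* Pf f (suc m) k ℚ.- frac K (suc n) ℚ.* Pf f (suc m) K
      ≡⟨ cong₂ (λ x y → 1ℚ ℚ.- frac k (suc n) ℚ.* x ℚ.- frac K (suc n) ℚ.* y)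
               (Pf≡frac-Wf f z<s 1≤k) (Pf≡frac-Wf f z<s 1≤K) ⟩
    1ℚ ℚ.- frac k (suc n) ℚ.* frac (Wf f (suc m) k) (suc m * k) ℚ.- frac K (suc n) ℚ.* frac (Wf f (suc m) K) (suc m * K)
      ≡⟨ question-value (m+[n∸m]≡n (<⇒≤ k<n)) 1≤k 1≤K z<s (Wf≤n*m f z<s) (Wf≤n*m f z<s) ⟩
    frac (h k) (suc n * suc m) ∎
    where
    K = suc n ∸ k
    1≤K = m<n⇒0<n∸m k<n

P≡frac-W : ∀ {n m} → 1 ≤ n → 1 ≤ m → P n m ≡ frac (W n m) (n * m)
P≡frac-W {n} {m} = Pf≡frac-Wf (n + m)

value-question : ∀ {n m k} → 1 ≤ m → 1 ≤ k → k + k ≤ n → value n m k ≡ frac (splitValue n m k) (n * m)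
value-question {n} {m} {suc j} 1≤m 1≤k k+k≤n with part<whole 1≤k k+k≤n
... | k<n , _ = begin
  1ℚ ℚ.- frac k n ℚ.* P m k ℚ.- frac K n ℚ.* P m K
    ≡⟨ cong₂ (λ x y → 1ℚ ℚ.- frac k n ℚ.* x ℚ.- frac K n ℚ.* y) (P≡frac-W 1≤m 1≤k) (P≡frac-W 1≤m 1≤K) ⟩
  1ℚ ℚ.- frac k n ℚ.* frac (W m k) (m * k) ℚ.- frac K n ℚ.* frac (W m K) (m * K)
    ≡⟨ question-value (m+[n∸m]≡n (<⇒≤ k<n)) 1≤k 1≤K 1≤m (W≤n*m 1≤m) (W≤n*m 1≤m) ⟩
  frac (splitValue n m k) (n * m) ∎
  where
  open ≡-Reasoning
  k = suc j
  K = n ∸ k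
  1≤K = m<n⇒0<n∸m k<n

guess-optimal : ∀ {n m} → 1 ≤ n → 1 ≤ m → W n m ≡ m → Optimal n m 0
guess-optimal {suc n} {suc m} _ _ W≡m =
  inj₁ refl , trans (frac-1 n m) (trans (cong (λ w → frac w (suc n * suc m)) (sym W≡m)) (sym (P≡frac-W {suc n} {suc m} z<s z<s)))

question-optimal : ∀ {n m k} → 1 ≤ m → 1 ≤ k → k + k ≤ n → W n m ≡ splitValue n m k → Optimal n m k
question-optimal {n} {m} {k} 1≤m 1≤k k+k≤n W≡ =
  inj₂ (1≤k , k+k≤n⇒k≤n/2 k+k≤n) ,
  trans (value-question 1≤m 1≤k k+k≤n)
        (trans (cong (λ w → frac w (n * m)) (sym W≡)) (sym (P≡frac-W (≤-trans 1≤k (≤-trans (m≤m+n k k) k+k≤n)) 1≤m)))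

-- Parity and n_<

c+c≡2*c : ∀ c → c + c ≡ 2 * c
c+c≡2*c c = cong (c +_) (sym (+-identityʳ c))

double-injective : ∀ {a b} → a + a ≡ b + b → a ≡ b
double-injective {a} {b} eq = *-cancelˡ-≡ a b 2 (trans (sym (c+c≡2*c a)) (trans eq (c+c≡2*c b)))

even≢odd′ : ∀ a b → a + a ≢ suc (b + b)
even≢odd′ a b eq = even≢odd a b (trans (sym (c+c≡2*c a)) (trans eq (cong suc (c+c≡2*c b))))

data EvenOdd : ℕ → Set where
  even : ∀ c → EvenOdd (c + c)
  odd  : ∀ c → EvenOdd (suc (c + c))

evenOdd : ∀ n → EvenOdd n
evenOdd zero = even 0
evenOdd (suc n) with evenOdd n
... | even c = odd c
... | odd c  = subst EvenOdd (cong suc (+-suc c c)) (even (suc c))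

data Residue4 : ℕ → Set where
  [4t]   : ∀ t → Residue4 ((t + t) + (t + t))
  [4t+1] : ∀ t → Residue4 (1 + ((t + t) + (t + t)))
  [4t+2] : ∀ t → Residue4 (2 + ((t + t) + (t + t)))
  [4t+3] : ∀ t → Residue4 (3 + ((t + t) + (t + t)))

residue4 : ∀ n → Residue4 n
residue4 n with evenOdd n
... | even c with evenOdd c
...   | even t = [4t] t
...   | odd t  = subst Residue4 (sym (shift t)) ([4t+2] t)
  where
  shift : ∀ t → suc (t + t) + suc (t + t) ≡ 2 + ((t + t) + (t + t))
  shift = solve-∀
residue4 n | odd c with evenOdd c
...   | even t = [4t+1] t
...   | odd t  = subst Residue4 (sym (shift t)) ([4t+3] t)
  where
  shift : ∀ t → suc (suc (t + t) + suc (t + t)) ≡ 3 + ((t + t) + (t + t))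
  shift = solve-∀

nLess-≢2 : ∀ {n} → n ≢ 2 → nLess n ≡ n / 4 + (n + 1) / 4
nLess-≢2 {n} ≢2 with n ≡ᵇ 2 in eq
... | true  = contradiction (≡ᵇ⇒≡ n 2 (subst T (sym eq) _)) ≢2
... | false = refl

nLess-mod4 : ∀ r t → r + t * 4 ≢ 2 → nLess (r + t * 4) ≡ (r / 4 + t) + ((1 + r) / 4 + t)
nLess-mod4 r t ≢2 = trans (nLess-≢2 ≢2) (cong₂ _+_ (quarter r) (trans (cong (_/ 4) (+-comm (r + t * 4) 1)) (quarter (1 + r))))
  where
  quarter : ∀ r → (r + t * 4) / 4 ≡ r / 4 + t
  quarter r = trans (+-distrib-/-∣ʳ r (n∣m*n t)) (cong (r / 4 +_) (m*n/n≡m t 4))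

private
  4t-form : ∀ r t → r + ((t + t) + (t + t)) ≡ r + t * 4
  4t-form = solve-∀

  t*4≢1 : ∀ t → t * 4 ≢ 1
  t*4≢1 zero    ()
  t*4≢1 (suc t) ()

  t*4≢2 : ∀ t → t * 4 ≢ 2
  t*4≢2 zero    ()
  t*4≢2 (suc t) ()

nLess-4t : ∀ t → nLess ((t + t) + (t + t)) ≡ t + t
nLess-4t t = trans (cong nLess (4t-form 0 t)) (nLess-mod4 0 t (t*4≢2 t))

nLess-4t+1 : ∀ t → nLess (1 + ((t + t) + (t + t))) ≡ t + t
nLess-4t+1 t = trans (cong nLess (4t-form 1 t)) (nLess-mod4 1 t (t*4≢1 t ∘ suc-injective))

nLess-4t+2 : ∀ {t} → 1 ≤ t → nLess (2 + ((t + t) + (t + t))) ≡ t + t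
nLess-4t+2 {suc t} _ = trans (cong nLess (4t-form 2 (suc t))) (nLess-mod4 2 (suc t) (λ ()))

nLess-4t+3 : ∀ t → nLess (3 + ((t + t) + (t + t))) ≡ suc (t + t)
nLess-4t+3 t = trans (cong nLess (4t-form 3 t)) (trans (nLess-mod4 3 t (λ ())) (+-suc t t))

nLess-odd : ∀ i → nLess (suc (i + i)) ≡ i
nLess-odd i with evenOdd i
... | even t = nLess-4t+1 t
... | odd t  = trans (cong nLess (shift t)) (nLess-4t+3 t)
  where
  shift : ∀ t → suc (suc (t + t) + suc (t + t)) ≡ 3 + ((t + t) + (t + t))
  shift = solve-∀

3≤nLess : ∀ {n} → 7 ≤ n → 3 ≤ nLess n
3≤nLess {n} 7≤n rewrite nLess-≢2 {n} (λ { refl → contradiction 7≤n λ { (s≤s (s≤s ())) } }) =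
  +-mono-≤ (/-monoˡ-≤ 4 7≤n) (/-monoˡ-≤ 4 (+-monoˡ-≤ 1 7≤n))

nLess-bounds : ∀ {n} → 2 ≤ n → 1 ≤ nLess n × nLess n + nLess n ≤ n
nLess-bounds {n} 2≤n with residue4 n
... | [4t] zero      = contradiction 2≤n λ ()
... | [4t+1] zero    = contradiction 2≤n λ { (s≤s ()) }
... | [4t] (suc t)   rewrite nLess-4t (suc t) = z<s , ≤-refl
... | [4t+1] (suc t) rewrite nLess-4t+1 (suc t) = z<s , n≤1+n _
... | [4t+2] zero    = z<s , ≤-refl
... | [4t+2] (suc t) rewrite nLess-4t+2 {suc t} z<s = z<s , m≤n+m _ 2
... | [4t+3] t       rewrite nLess-4t+3 t = z<s , s≤s (≤-trans (≤-reflexive (+-suc (t + t) (t + t))) (n≤1+n _))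

-- Concavity in steps of three

Concave₃At : (ℕ → ℕ) → ℕ → Set
Concave₃At F i = F i + F (3 + i) ≤ F (1 + i) + F (2 + i)

Concave₃ : (ℕ → ℕ) → ℕ → Set
Concave₃ F N = ∀ {i} → 1 ≤ i → 3 + i ≤ N → Concave₃At F i

module _ {F : ℕ → ℕ} {N : ℕ} (concave : Concave₃ F N) where

  concave-step : ∀ {k l} → 1 ≤ k → k ≤′ l → 2 + l ≤ N → F k + F (2 + l) ≤ F (2 + k) + F l
  concave-step {k} 1≤k ≤′-refl _ = ≤-reflexive (+-comm (F k) _)
  concave-step {k} {suc l} 1≤k (≤′-step k≤l) 3+l≤N = +-cancelʳ-≤ (F (2 + l) + F l) _ _ (begin
    (F k + F (3 + l)) + (F (2 + l) + F l)      ≡⟨ regroup (F k) (F (3 + l)) (F (2 + l)) (F l) ⟩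
    (F k + F (2 + l)) + (F l + F (3 + l))      ≤⟨ +-mono-≤ (concave-step 1≤k k≤l (≤-trans (n≤1+n _) 3+l≤N))
                                                          (concave (≤-trans 1≤k (≤′⇒≤ k≤l)) 3+l≤N) ⟩
    (F (2 + k) + F l) + (F (1 + l) + F (2 + l)) ≡⟨ regroup (F (2 + k)) (F l) (F (1 + l)) (F (2 + l)) ⟩
    (F (2 + k) + F (1 + l)) + (F (2 + l) + F l) ∎)
    where
    open ≤-Reasoning
    regroup : ∀ a b c d → (a + b) + (c + d) ≡ (a + c) + (d + b)
    regroup = solve-∀

  private
    shift : ∀ k δ → k + (4 + δ) ≡ 2 + ((2 + k) + δ)
    shift = solve-∀

    step-inward : ∀ {k δ} → 1 ≤ k → k + (4 + δ) ≤ N → F k + F (k + (4 + δ)) ≤ F (2 + k) + F ((2 + k) + δ)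
    step-inward {k} {δ} 1≤k bound = subst (λ x → F k + F x ≤ F (2 + k) + F ((2 + k) + δ)) (sym (shift k δ))
      (concave-step 1≤k (≤⇒≤′ (≤-trans (m≤n+m k 2) (m≤m+n (2 + k) δ))) (≤-trans (≤-reflexive (sym (shift k δ))) bound))

    inward-total : ∀ k δ → (2 + k) + ((2 + k) + δ) ≡ k + (k + (4 + δ))
    inward-total = solve-∀

    inward-bound : ∀ k δ → (2 + k) + δ ≤ k + (4 + δ)
    inward-bound k δ = ≤-trans (m≤n+m _ 2) (≤-reflexive (sym (shift k δ)))

    sum₀ : ∀ k → k + (k + 0) ≡ k + k
    sum₀ = solve-∀
    sum₁ : ∀ k → k + (k + 1) ≡ suc (k + k)
    sum₁ = solve-∀
    sum₂ : ∀ k → k + (k + 2) ≡ suc k + suc k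
    sum₂ = solve-∀
    sum₃ : ∀ k → k + (k + 3) ≡ suc (suc k + suc k)
    sum₃ = solve-∀

  center-odd : ∀ δ {k c} → 1 ≤ k → k + (k + δ) ≡ suc (c + c) → k + δ ≤ N → F k + F (k + δ) ≤ F c + F (suc c)
  center-odd 0 {k} {c} _ eq _ = contradiction (trans (sym (sum₀ k)) eq) (even≢odd′ k c)
  center-odd 1 {k} {c} _ eq _ with double-injective {k} {c} (suc-injective (trans (sym (sum₁ k)) eq))
  ... | refl = ≤-reflexive (cong (λ x → F k + F x) (+-comm k 1))
  center-odd 2 {k} {c} _ eq _ = contradiction (trans (sym (sum₂ k)) eq) (even≢odd′ (suc k) c)
  center-odd 3 {k} {c} 1≤k eq bound with double-injective {suc k} {c} (suc-injective (trans (sym (sum₃ k)) eq))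
  ... | refl = begin
    F k + F (k + 3)          ≡⟨ cong (λ x → F k + F x) (+-comm k 3) ⟩
    F k + F (2 + suc k)      ≤⟨ concave-step 1≤k (≤′-step ≤′-refl) (≤-trans (≤-reflexive (+-comm 3 k)) bound) ⟩
    F (2 + k) + F (suc k)    ≡⟨ +-comm (F (2 + k)) (F (suc k)) ⟩
    F (suc k) + F (2 + k)    ∎
    where open ≤-Reasoning
  center-odd (suc (suc (suc (suc δ)))) {k} 1≤k eq bound =
    ≤-trans (step-inward 1≤k bound)
            (center-odd δ (≤-trans 1≤k (m≤n+m k 2)) (trans (inward-total k δ) eq) (≤-trans (inward-bound k δ) bound))

  center-even : ∀ δ {k c} → 1 ≤ k → k + (k + δ) ≡ c + c → k + δ ≤ N →
                F k + F (k + δ) ≤ (F c + F c) ⊔ (F (c ∸ 1) + F (suc c))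
  center-even 0 {k} {c} _ eq _ with double-injective {k} {c} (trans (sym (sum₀ k)) eq)
  ... | refl = m≤n⇒m≤n⊔o _ (≤-reflexive (cong (λ x → F k + F x) (+-identityʳ k)))
  center-even 1 {k} {c} _ eq _ = contradiction (trans (sym eq) (sum₁ k)) (even≢odd′ c k)
  center-even 2 {k} {c} _ eq _ with double-injective {suc k} {c} (trans (sym (sum₂ k)) eq)
  ... | refl = m≤n⇒m≤o⊔n _ (≤-reflexive (cong (λ x → F k + F x) (+-comm k 2)))
  center-even 3 {k} {c} _ eq _ = contradiction (trans (sym eq) (sum₃ k)) (even≢odd′ c (suc k))
  center-even (suc (suc (suc (suc δ)))) {k} 1≤k eq bound =
    ≤-trans (step-inward 1≤k bound)
            (center-even δ (≤-trans 1≤k (m≤n+m k 2)) (trans (inward-total k δ) eq) (≤-trans (inward-bound k δ) bound))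

private
  split-offset : ∀ {n k} → k + k ≤ n → k + (k + (n ∸ (k + k))) ≡ n × k + (n ∸ (k + k)) ≡ n ∸ k
  split-offset {n} {k} k+k≤n = total , sym (trans (cong (_∸ k) (sym total)) (m+n∸m≡n k _))
    where
    total : k + (k + (n ∸ (k + k))) ≡ n
    total = trans (sym (+-assoc k k _)) (m+[n∸m]≡n k+k≤n)

odd-split≤center : ∀ {F c k} → Concave₃ F (c + c) → 1 ≤ k → k + k ≤ suc (c + c) →
                   F k + F (suc (c + c) ∸ k) ≤ F c + F (suc c)
odd-split≤center {F} {c} {k} concave 1≤k k+k≤n with split-offset {suc (c + c)} {k} k+k≤n
... | total , part = subst (λ x → F k + F x ≤ F c + F (suc c)) part
  (center-odd {F} concave (suc (c + c) ∸ (k + k)) {k} {c} 1≤k total (≤-trans (≤-reflexive part) (∸-monoʳ-≤ (suc (c + c)) 1≤k)))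

even-split≤center : ∀ {F c k} → Concave₃ F (c + c ∸ 1) → 1 ≤ k → k + k ≤ c + c →
                    F k + F (c + c ∸ k) ≤ (F c + F c) ⊔ (F (c ∸ 1) + F (suc c))
even-split≤center {F} {c} {k} concave 1≤k k+k≤n with split-offset {c + c} {k} k+k≤n
... | total , part = subst (λ x → F k + F x ≤ (F c + F c) ⊔ (F (c ∸ 1) + F (suc c))) part
  (center-even {F} concave (c + c ∸ (k + k)) {k} {c} 1≤k total (≤-trans (≤-reflexive part) (∸-monoʳ-≤ (c + c) 1≤k)))

-- Transfer from W to L

L+W-split : ∀ {m j a b} → a + b ≡ m → 1 ≤ m → 1 ≤ j → L m j + W m j ≡ (L j a + L j b) + (W j a + W j b)
L+W-split {m} {j} {a} {b} a+b≡m 1≤m 1≤j = begin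
  L m j + W m j                          ≡⟨ L+W≡m*k 1≤m ⟩
  m * j                                  ≡⟨ *-comm m j ⟩
  j * m                                  ≡⟨ cong (j *_) (sym a+b≡m) ⟩
  j * (a + b)                            ≡⟨ *-distribˡ-+ j a b ⟩
  j * a + j * b                          ≡⟨ cong₂ _+_ (sym (L+W≡m*k 1≤j)) (sym (L+W≡m*k 1≤j)) ⟩
  (L j a + W j a) + (L j b + W j b)      ≡⟨ interchange (L j a) (W j a) (L j b) (W j b) ⟩
  (L j a + L j b) + (W j a + W j b)      ∎
  where open ≡-Reasoning

L≤W+W : ∀ {m j a b} → a + b ≡ m → 1 ≤ a → 1 ≤ b → 1 ≤ j → L m j ≤ W j a + W j b
L≤W+W {m} {j} {a} {b} a+b≡m 1≤a 1≤b 1≤j = +-cancelˡ-≤ (L j a + L j b) (L m j) (W j a + W j b) (begin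
  (L j a + L j b) + L m j            ≤⟨ +-monoˡ-≤ (L m j) (L+L≤W a b a+b≡m 1≤a 1≤b) ⟩
  W m j + L m j                      ≡⟨ +-comm (W m j) (L m j) ⟩
  L m j + W m j                      ≡⟨ L+W-split a+b≡m 1≤m 1≤j ⟩
  (L j a + L j b) + (W j a + W j b)  ∎)
  where
  open ≤-Reasoning
  1≤m = ≤-trans 1≤a (≤-trans (m≤m+n a b) (≤-reflexive a+b≡m))

L≡W+W : ∀ {m j a b} → a + b ≡ m → 1 ≤ m → 1 ≤ j → W m j ≡ L j a + L j b → L m j ≡ W j a + W j b
L≡W+W {m} {j} {a} {b} a+b≡m 1≤m 1≤j W≡ = +-cancelˡ-≡ (L j a + L j b) (L m j) (W j a + W j b) (begin
  (L j a + L j b) + L m j            ≡⟨ cong (_+ L m j) (sym W≡) ⟩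
  W m j + L m j                      ≡⟨ +-comm (W m j) (L m j) ⟩
  L m j + W m j                      ≡⟨ L+W-split a+b≡m 1≤m 1≤j ⟩
  (L j a + L j b) + (W j a + W j b)  ∎)
  where open ≡-Reasoning

NLessOptimal : ℕ → ℕ → Set
NLessOptimal n m = W n m ≡ splitValue n m (nLess n)

L-exchange : ∀ {m i j i′ j′} → 2 ≤ m → 1 ≤ i → 1 ≤ j → 1 ≤ i′ → 1 ≤ j′ → NLessOptimal m i′ → NLessOptimal m j′ →
  (∀ {x} → nLess m ≤ x → x < m → W i x + W j x ≤ W i′ x + W j′ x) →
  L m i + L m j ≤ L m i′ + L m j′
L-exchange {m} {i} {j} {i′} {j′} 2≤m 1≤i 1≤j 1≤i′ 1≤j′ optimal-i′ optimal-j′ exchange = begin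
  L m i + L m j                          ≤⟨ +-mono-≤ (L≤W+W a+b≡m 1≤a 1≤b 1≤i) (L≤W+W a+b≡m 1≤a 1≤b 1≤j) ⟩
  (W i a + W i b) + (W j a + W j b)      ≡⟨ interchange (W i a) (W i b) (W j a) (W j b) ⟩
  (W i a + W j a) + (W i b + W j b)      ≤⟨ +-mono-≤ (exchange ≤-refl a<m) (exchange a≤b b<m) ⟩
  (W i′ a + W j′ a) + (W i′ b + W j′ b)  ≡⟨ interchange (W i′ a) (W j′ a) (W i′ b) (W j′ b) ⟩
  (W i′ a + W i′ b) + (W j′ a + W j′ b)  ≡⟨ sym (cong₂ _+_ (L≡W+W a+b≡m 1≤m 1≤i′ optimal-i′)
                                                           (L≡W+W a+b≡m 1≤m 1≤j′ optimal-j′)) ⟩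
  L m i′ + L m j′                        ∎
  where
  open ≤-Reasoning
  a = nLess m
  b = m ∸ nLess m
  1≤m = ≤-trans (s≤s z≤n) 2≤m
  bounds = nLess-bounds 2≤m
  1≤a = proj₁ bounds
  a≤b : a ≤ b
  a≤b = ≤-trans (≤-reflexive (sym (m+n∸m≡n a a))) (∸-monoˡ-≤ a (proj₂ bounds))
  1≤b = ≤-trans 1≤a a≤b
  a+b≡m = m+[n∸m]≡n (≤-trans (m≤m+n a a) (proj₂ bounds))
  a<m = ≤-trans (≤-reflexive (+-comm 1 a)) (≤-trans (+-monoʳ-≤ a 1≤b) (≤-reflexive a+b≡m))
  b<m = ≤-trans (≤-reflexive (+-comm 1 b)) (≤-trans (+-monoʳ-≤ b 1≤a) (≤-reflexive (trans (+-comm b a) a+b≡m)))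

-- The induction

Exceptional : ℕ → ℕ → Set
Exceptional n m = m ≡ 4 × (n ≡ 4 ⊎ n ≡ 6 ⊎ n ≡ 10)

exceptional? : ∀ n m → Dec (Exceptional n m)
exceptional? n m = (m ≟ 4) ×-dec ((n ≟ 4) ⊎-dec ((n ≟ 6) ⊎-dec (n ≟ 10)))

odd-¬exceptional : ∀ {i m} → ¬ Exceptional (suc (i + i)) m
odd-¬exceptional {i} (_ , inj₁ eq)        = even≢odd′ 2 i (sym eq)
odd-¬exceptional {i} (_ , inj₂ (inj₁ eq)) = even≢odd′ 3 i (sym eq)
odd-¬exceptional {i} (_ , inj₂ (inj₂ eq)) = even≢odd′ 5 i (sym eq)

by-computation : ∀ {a b} {_ : T (a ≤ᵇ b)} → a ≤ b
by-computation {a} {b} {a≤ᵇb} = ≤ᵇ⇒≤ a b a≤ᵇb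

record FactsBelow (N : ℕ) : Set where
  field
    nLess-optimal : ∀ {n m} → 2 ≤ n → 2 ≤ m → ¬ Exceptional n m → n + m < N → NLessOptimal n m
    L-concave₃    : ∀ {m k} → 2 ≤ m → 1 ≤ k → m + (3 + k) < N → Concave₃At (L m) k

L-concave₃-at-1-small : ∀ {m} → 2 ≤ m → m ≤ 6 → Concave₃At (L m) 1
L-concave₃-at-1-small {1} (s≤s ()) _
L-concave₃-at-1-small {2} _ _ = by-computation
L-concave₃-at-1-small {3} _ _ = by-computation
L-concave₃-at-1-small {4} _ _ = by-computation
L-concave₃-at-1-small {5} _ _ = by-computation
L-concave₃-at-1-small {6} _ _ = by-computation
L-concave₃-at-1-small {suc (suc (suc (suc (suc (suc (suc _))))))} _ (s≤s (s≤s (s≤s (s≤s (s≤s (s≤s ()))))))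

L-midpoint-2-small : ∀ {m} → 2 ≤ m → m ≤ 6 → m ≢ 4 → L m 1 + L m 3 ≤ L m 2 + L m 2
L-midpoint-2-small {1} (s≤s ()) _ _
L-midpoint-2-small {2} _ _ _ = by-computation
L-midpoint-2-small {3} _ _ _ = by-computation
L-midpoint-2-small {4} _ _ m≢4 = contradiction refl m≢4
L-midpoint-2-small {5} _ _ _ = by-computation
L-midpoint-2-small {6} _ _ _ = by-computation
L-midpoint-2-small {suc (suc (suc (suc (suc (suc (suc _))))))} _ (s≤s (s≤s (s≤s (s≤s (s≤s (s≤s ())))))) _

module InductionStep {N : ℕ} (facts : FactsBelow N) where
  open FactsBelow facts

  private
    pairs : ∀ u a b → (a + u) + (b + u) ≡ (a + b) + (u + u)
    pairs = solve-∀

    below : ∀ {j b x} → j ≤ b → b + x < N → j + x < N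
    below j≤b = ≤-<-trans (+-monoˡ-≤ _ j≤b)

    part-total : ∀ {x m j j′} → x < m → j ≤ j′ → m + j′ ≡ N → j + x < N
    part-total {x} {m} {j} {j′} x<m j≤j′ total =
      ≤-trans (+-monoʳ-< j x<m) (≤-trans (+-monoˡ-≤ m j≤j′) (≤-reflexive (trans (+-comm j′ m) total)))

    index-total : ∀ {m j j′} → j < j′ → m + j′ ≡ N → m + j < N
    index-total {m} j<j′ total = ≤-trans (+-monoʳ-< m j<j′) (≤-reflexive total)

    L-concave₃-below : ∀ {m M} → 2 ≤ m → m + M < N → Concave₃ (L m) M
    L-concave₃-below 2≤m bound 1≤i 3+i≤M = L-concave₃ 2≤m 1≤i (≤-<-trans (+-monoʳ-≤ _ 3+i≤M) bound)

    nLess≤⇒1≤ : ∀ {m x} → 2 ≤ m → nLess m ≤ x → 1 ≤ x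
    nLess≤⇒1≤ 2≤m nLess≤x = ≤-trans (proj₁ (nLess-bounds 2≤m)) nLess≤x

    ¬exceptional-≢4 : ∀ {m j} → j ≢ 4 → ¬ Exceptional m j
    ¬exceptional-≢4 j≢4 (j≡4 , _) = j≢4 j≡4

    nLess-optimal-by : ∀ {n m k} → nLess n ≡ k → W n m ≡ splitValue n m k → NLessOptimal n m
    nLess-optimal-by {n} {m} nLess≡k W≡ = trans W≡ (cong (splitValue n m) (sym nLess≡k))

    exchange-at-1 : ∀ i j i′ j′ → W i 1 + W j 1 ≤ W i′ 1 + W j′ 1
    exchange-at-1 i j i′ j′ rewrite W[n,1]≡1 {i} | W[n,1]≡1 {j} | W[n,1]≡1 {i′} | W[n,1]≡1 {j′} = ≤-refl

  W-odd : ∀ {n x i} → n ≡ suc (i + i) → 1 ≤ i → 2 ≤ x → n + x < N → W n x ≡ L x i + L x (suc i)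
  W-odd {x = x} {i} refl 1≤i 2≤x n+x<N = begin
    W n x                            ≡⟨ nLess-optimal (s≤s (≤-trans 1≤i (m≤m+n i i))) 2≤x (odd-¬exceptional {i}) n+x<N ⟩
    splitValue n x (nLess n)         ≡⟨ cong (splitValue n x) (nLess-odd i) ⟩
    L x i + L x (n ∸ i)              ≡⟨ cong (λ y → L x i + L x y) (trans (cong (_∸ i) (sym (+-suc i i))) (m+n∸m≡n i (suc i))) ⟩
    L x i + L x (suc i)              ∎
    where
    open ≡-Reasoning
    n = suc (i + i)

  W-4t : ∀ {n x u t} → u ≡ t + t → n ≡ u + u → 1 ≤ t → 2 ≤ x → ¬ Exceptional n x → n + x < N →
         W n x ≡ L x u + L x u
  W-4t {x = x} {t = t} refl refl 1≤t 2≤x ¬exc n+x<N = begin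
    W n x                            ≡⟨ nLess-optimal 2≤n 2≤x ¬exc n+x<N ⟩
    splitValue n x (nLess n)         ≡⟨ cong (splitValue n x) (nLess-4t t) ⟩
    L x u + L x (n ∸ u)              ≡⟨ cong (λ y → L x u + L x y) (m+n∸m≡n u u) ⟩
    L x u + L x u                    ∎
    where
    open ≡-Reasoning
    u = t + t
    n = u + u
    2≤n = ≤-trans (+-mono-≤ 1≤t 1≤t) (m≤m+n u u)

  W-4t+2 : ∀ {n x u t} → u ≡ t + t → n ≡ 2 + (u + u) → 1 ≤ t → 2 ≤ x → ¬ Exceptional n x → n + x < N →
           W n x ≡ L x u + L x (2 + u)
  W-4t+2 {x = x} {t = t} refl refl 1≤t 2≤x ¬exc n+x<N = begin
    W n x                            ≡⟨ nLess-optimal (m≤m+n 2 _) 2≤x ¬exc n+x<N ⟩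
    splitValue n x (nLess n)         ≡⟨ cong (splitValue n x) (nLess-4t+2 1≤t) ⟩
    L x u + L x (n ∸ u)              ≡⟨ cong (λ y → L x u + L x y) (trans (cong (_∸ u) (sym (pairs u 0 2))) (m+n∸m≡n u (2 + u))) ⟩
    L x u + L x (2 + u)              ∎
    where
    open ≡-Reasoning
    u = t + t
    n = 2 + (u + u)

  W-concave₃-4t : ∀ {x n t} → n ≡ (t + t) + (t + t) → 1 ≤ t → 2 ≤ x → ¬ Exceptional n x → (3 + n) + x < N →
                  Concave₃At (λ j → W j x) n
  W-concave₃-4t {x} {n} {t} refl 1≤t 2≤x ¬exc bound = begin
    W n x + W (3 + n) x
      ≡⟨ cong₂ _+_ (W-4t refl refl 1≤t 2≤x ¬exc (below (m≤n+m n 3) bound)) (W-odd (cong suc (sym (pairs u 1 1))) z<s 2≤x bound) ⟩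
    (L x u + L x u) + (L x (1 + u) + L x (2 + u))
      ≡⟨ regroup (L x u) (L x (1 + u)) (L x (2 + u)) ⟩
    (L x u + L x (1 + u)) + (L x u + L x (2 + u))
      ≤⟨ +-mono-≤ (L+L≤W u (1 + u) (pairs u 0 1) 1≤u z<s) (L+L≤W u (2 + u) (pairs u 0 2) 1≤u z<s) ⟩
    W (1 + n) x + W (2 + n) x ∎
    where
    open ≤-Reasoning
    u = t + t
    1≤u = ≤-trans 1≤t (m≤m+n t t)
    regroup : ∀ a b c → (a + a) + (b + c) ≡ (a + b) + (a + c)
    regroup = solve-∀

  W-concave₃-4t+1 : ∀ {x n t} → n ≡ 1 + ((t + t) + (t + t)) → 1 ≤ t → 2 ≤ x → ¬ Exceptional (3 + n) x → (3 + n) + x < N →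
                    Concave₃At (λ j → W j x) n
  W-concave₃-4t+1 {x} {n} {t} refl 1≤t 2≤x ¬exc bound = begin
    W n x + W (3 + n) x
      ≡⟨ cong₂ _+_ (W-odd refl 1≤u 2≤x (below (m≤n+m n 3) bound))
                   (W-4t {u = 2 + u} {t = suc t} (sym (pairs t 1 1)) (sym (pairs u 2 2)) z<s 2≤x ¬exc bound) ⟩
    (L x u + L x (1 + u)) + (L x (2 + u) + L x (2 + u))
      ≡⟨ regroup (L x u) (L x (1 + u)) (L x (2 + u)) ⟩
    (L x u + L x (2 + u)) + (L x (1 + u) + L x (2 + u))
      ≤⟨ +-mono-≤ (L+L≤W u (2 + u) (pairs u 0 2) 1≤u z<s) (L+L≤W (1 + u) (2 + u) (pairs u 1 2) z<s z<s) ⟩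
    W (1 + n) x + W (2 + n) x ∎
    where
    open ≤-Reasoning
    u = t + t
    1≤u = ≤-trans 1≤t (m≤m+n t t)
    regroup : ∀ a b c → (a + b) + (c + c) ≡ (a + c) + (b + c)
    regroup = solve-∀

  W-concave₃-4t+2 : ∀ {x n t} → n ≡ 2 + ((t + t) + (t + t)) → 2 ≤ x → ¬ Exceptional n x → (3 + n) + x < N →
                    Concave₃At (λ j → W j x) n
  W-concave₃-4t+2 {x} {t = zero} refl 2≤x _ bound = begin
    W 2 x + W 5 x
      ≡⟨ cong₂ _+_ (W[2,m]≡L+L 2≤x) (W-odd {i = 2} refl z<s 2≤x bound) ⟩
    (L x 1 + L x 1) + (L x 2 + L x 3)
      ≡⟨ regroup (L x 1) (L x 2) (L x 3) ⟩
    (L x 1 + L x 2) + (L x 1 + L x 3)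
      ≤⟨ +-mono-≤ (L+L≤W {x} 1 2 refl z<s z<s) (L+L≤W {x} 1 3 refl z<s z<s) ⟩
    W 3 x + W 4 x ∎
    where
    open ≤-Reasoning
    regroup : ∀ a b c → (a + a) + (b + c) ≡ (a + b) + (a + c)
    regroup = solve-∀
  W-concave₃-4t+2 {x} {n} {t@(suc _)} refl 2≤x ¬exc bound = begin
    W n x + W (3 + n) x
      ≡⟨ cong₂ _+_ (W-4t+2 refl refl z<s 2≤x ¬exc (below (m≤n+m n 3) bound)) (W-odd (cong suc (sym (pairs u 2 2))) z<s 2≤x bound) ⟩
    (L x u + L x (2 + u)) + (L x (2 + u) + L x (3 + u))
      ≡⟨ regroup (L x u) (L x (2 + u)) (L x (3 + u)) ⟩
    (L x u + L x (3 + u)) + (L x (2 + u) + L x (2 + u))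
      ≤⟨ +-monoˡ-≤ _ (L-concave₃-below 2≤x (≤-<-trans (≤-reflexive (+-comm x (3 + n))) bound) 1≤u (+-monoʳ-≤ 3 u≤n)) ⟩
    (L x (1 + u) + L x (2 + u)) + (L x (2 + u) + L x (2 + u))
      ≤⟨ +-mono-≤ (L+L≤W (1 + u) (2 + u) (pairs u 1 2) z<s z<s) (L+L≤W (2 + u) (2 + u) (pairs u 2 2) z<s z<s) ⟩
    W (1 + n) x + W (2 + n) x ∎
    where
    open ≤-Reasoning
    u = t + t
    1≤u = m≤m+n 1 _
    u≤n = ≤-trans (m≤m+n u u) (m≤n+m _ 2)
    regroup : ∀ a c d → (a + c) + (c + d) ≡ (a + d) + (c + c)
    regroup = solve-∀

  W-concave₃-4t+3 : ∀ {x n t} → n ≡ 3 + ((t + t) + (t + t)) → 2 ≤ x → ¬ Exceptional (3 + n) x → (3 + n) + x < N →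
                    Concave₃At (λ j → W j x) n
  W-concave₃-4t+3 {x} {n} {t} refl 2≤x ¬exc bound = begin
    W n x + W (3 + n) x
      ≡⟨ cong₂ _+_ (W-odd (cong suc (sym (pairs u 1 1))) z<s 2≤x (below (m≤n+m n 3) bound))
                   (W-4t+2 {u = 2 + u} {t = suc t} (sym (pairs t 1 1)) (cong (2 +_) (sym (pairs u 2 2))) z<s 2≤x ¬exc bound) ⟩
    (L x (1 + u) + L x (2 + u)) + (L x (2 + u) + L x (4 + u))
      ≡⟨ regroup (L x (1 + u)) (L x (2 + u)) (L x (4 + u)) ⟩
    (L x (1 + u) + L x (4 + u)) + (L x (2 + u) + L x (2 + u))
      ≤⟨ +-monoˡ-≤ _ (L-concave₃-below 2≤x (≤-<-trans (≤-reflexive (+-comm x (3 + n))) bound) z<s (+-monoʳ-≤ 3 1+u≤n)) ⟩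
    (L x (2 + u) + L x (3 + u)) + (L x (2 + u) + L x (2 + u))
      ≡⟨ +-comm (L x (2 + u) + L x (3 + u)) _ ⟩
    (L x (2 + u) + L x (2 + u)) + (L x (2 + u) + L x (3 + u))
      ≤⟨ +-mono-≤ (L+L≤W (2 + u) (2 + u) (pairs u 2 2) z<s z<s) (L+L≤W (2 + u) (3 + u) (pairs u 2 3) z<s z<s) ⟩
    W (1 + n) x + W (2 + n) x ∎
    where
    open ≤-Reasoning
    u = t + t
    1+u≤n = s≤s (≤-trans (m≤m+n u u) (m≤n+m _ 2))
    regroup : ∀ a c d → (a + c) + (c + d) ≡ (a + d) + (c + c)
    regroup = solve-∀

  W-concave₃-regular : ∀ {x n} → 2 ≤ x → 2 ≤ n → ¬ Exceptional n x → ¬ Exceptional (3 + n) x → (3 + n) + x < N →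
                       Concave₃At (λ j → W j x) n
  W-concave₃-regular {n = n} 2≤x 2≤n ¬e₀ ¬e₃ bound with residue4 n
  ... | [4t] zero        = contradiction 2≤n λ ()
  ... | [4t] t@(suc _)   = W-concave₃-4t {t = t} refl z<s 2≤x ¬e₀ bound
  ... | [4t+1] zero      = contradiction 2≤n λ { (s≤s ()) }
  ... | [4t+1] t@(suc _) = W-concave₃-4t+1 {t = t} refl z<s 2≤x ¬e₃ bound
  ... | [4t+2] t         = W-concave₃-4t+2 {t = t} refl 2≤x ¬e₀ bound
  ... | [4t+3] t         = W-concave₃-4t+3 {t = t} refl 2≤x ¬e₃ bound

  W-concave₃ : ∀ {x n} → 1 ≤ x → 2 ≤ n → (3 + n) + x < N → Concave₃At (λ j → W j x) n
  W-concave₃ {1} {n} _ _ _ = exchange-at-1 n (3 + n) (1 + n) (2 + n)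
  W-concave₃ {x@(suc (suc _))} {n} _ 2≤n bound with exceptional? n x | exceptional? (3 + n) x
  ... | yes (refl , inj₁ refl)        | _                            = by-computation
  ... | yes (refl , inj₂ (inj₁ refl)) | _                            = by-computation
  ... | yes (refl , inj₂ (inj₂ refl)) | _                            = by-computation
  ... | no _                          | yes (refl , inj₁ refl)        = contradiction 2≤n λ { (s≤s ()) }
  ... | no _                          | yes (refl , inj₂ (inj₁ refl)) = by-computation
  ... | no _                          | yes (refl , inj₂ (inj₂ refl)) = by-computation
  ... | no ¬e₀                        | no ¬e₃                       = W-concave₃-regular (s≤s (s≤s z≤n)) 2≤n ¬e₀ ¬e₃ bound

  W-concave₃-at-1 : ∀ {x} → 3 ≤ x → 4 + x < N → Concave₃At (λ j → W j x) 1
  W-concave₃-at-1 {x} 3≤x bound with x ≟ 4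
  ... | yes refl = by-computation
  ... | no x≢4 = begin
    x + W 4 x                            ≡⟨ cong (x +_) (W-4t {u = 2} {t = 1} refl refl ≤-refl 2≤x (x≢4 ∘ proj₁) bound) ⟩
    x + (L x 2 + L x 2)                  ≡⟨ sym (+-assoc x (L x 2) (L x 2)) ⟩
    (x + L x 2) + L x 2                  ≤⟨ +-monoˡ-≤ (L x 2) (x+L[x,2]≤3L[x,1] 3≤x) ⟩
    (L x 1 + (L x 1 + L x 1)) + L x 2    ≡⟨ regroup (L x 1) (L x 2) ⟩
    (L x 1 + L x 1) + (L x 1 + L x 2)    ≡⟨ sym (cong₂ _+_ (W[2,m]≡L+L 2≤x) (W-odd {i = 1} refl ≤-refl 2≤x (below (n≤1+n 3) bound))) ⟩
    W 2 x + W 3 x                        ∎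
    where
    open ≤-Reasoning
    2≤x = ≤-trans (n≤1+n 2) 3≤x
    regroup : ∀ a b → (a + (a + a)) + b ≡ (a + a) + (a + b)
    regroup = solve-∀

  W-midpoint-2 : ∀ {x} → 3 ≤ x → 3 + x < N → W 1 x + W 3 x ≤ W 2 x + W 2 x
  W-midpoint-2 {x} 3≤x bound = begin
    x + W 3 x                            ≡⟨ cong (x +_) (W-odd {i = 1} refl ≤-refl 2≤x bound) ⟩
    x + (L x 1 + L x 2)                  ≡⟨ regroup x (L x 1) (L x 2) ⟩
    (x + L x 2) + L x 1                  ≤⟨ +-monoˡ-≤ (L x 1) (x+L[x,2]≤3L[x,1] 3≤x) ⟩
    (L x 1 + (L x 1 + L x 1)) + L x 1    ≡⟨ regroup′ (L x 1) ⟩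
    (L x 1 + L x 1) + (L x 1 + L x 1)    ≡⟨ sym (cong₂ _+_ (W[2,m]≡L+L 2≤x) (W[2,m]≡L+L 2≤x)) ⟩
    W 2 x + W 2 x                        ∎
    where
    open ≤-Reasoning
    2≤x = ≤-trans (n≤1+n 2) 3≤x
    regroup : ∀ x a b → x + (a + b) ≡ (x + b) + a
    regroup = solve-∀
    regroup′ : ∀ a → (a + (a + a)) + a ≡ (a + a) + (a + a)
    regroup′ = solve-∀

  W-midpoint-odd : ∀ {x s} → 1 ≤ x → 1 ≤ s → (2 + (s + s)) + x < N →
                   W (suc (s + s)) x + W (suc (s + s)) x ≤ W (s + s) x + W (2 + (s + s)) x
  W-midpoint-odd {1} {s} _ _ _ = exchange-at-1 (suc (s + s)) (suc (s + s)) (s + s) (2 + (s + s))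
  W-midpoint-odd {x@(suc (suc _))} {s} _ 1≤s bound = begin
    W (suc (s + s)) x + W (suc (s + s)) x                  ≡⟨ cong₂ _+_ W[2s+1,x] W[2s+1,x] ⟩
    (L x s + L x (suc s)) + (L x s + L x (suc s))          ≡⟨ interchange (L x s) (L x (suc s)) (L x s) (L x (suc s)) ⟩
    (L x s + L x s) + (L x (suc s) + L x (suc s))          ≤⟨ +-mono-≤ (L+L≤W s s refl 1≤s 1≤s) (L+L≤W (1 + s) (1 + s) (pairs s 1 1) z<s z<s) ⟩
    W (s + s) x + W (2 + (s + s)) x                        ∎
    where
    open ≤-Reasoning
    W[2s+1,x] = W-odd refl 1≤s (s≤s (s≤s z≤n)) (below (n≤1+n (suc (s + s))) bound)

  W-midpoint-even : ∀ {x r} → 1 ≤ x → 1 ≤ r → (3 + (r + r)) + x < N →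
                    W (1 + (r + r)) x + W (3 + (r + r)) x ≤ W (2 + (r + r)) x + W (2 + (r + r)) x
  W-midpoint-even {1} {r} _ _ _ = exchange-at-1 (1 + (r + r)) (3 + (r + r)) (2 + (r + r)) (2 + (r + r))
  W-midpoint-even {x@(suc (suc _))} {r} _ 1≤r bound = begin
    W (1 + (r + r)) x + W (3 + (r + r)) x
      ≡⟨ cong₂ _+_ (W-odd refl 1≤r 2≤x (below (m≤n+m (1 + (r + r)) 2) bound)) (W-odd (cong suc (sym (pairs r 1 1))) z<s 2≤x bound) ⟩
    (L x r + L x (1 + r)) + (L x (1 + r) + L x (2 + r))
      ≡⟨ regroup (L x r) (L x (1 + r)) (L x (2 + r)) ⟩
    (L x (1 + r) + L x (1 + r)) + (L x r + L x (2 + r))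
      ≤⟨ +-mono-≤ (L+L≤W (1 + r) (1 + r) (pairs r 1 1) z<s z<s) (L+L≤W r (2 + r) (pairs r 0 2) 1≤r z<s) ⟩
    W (2 + (r + r)) x + W (2 + (r + r)) x ∎
    where
    open ≤-Reasoning
    2≤x = s≤s (s≤s z≤n)
    regroup : ∀ a b c → (a + b) + (b + c) ≡ (b + b) + (a + c)
    regroup = solve-∀

  L-concave₃-at : ∀ {m k} → 2 ≤ m → 1 ≤ k → m + (3 + k) ≡ N → Concave₃At (L m) k
  L-concave₃-at {m} {1} 2≤m _ total with m ≤? 6
  ... | yes m≤6 = L-concave₃-at-1-small 2≤m m≤6
  ... | no m≰6  = L-exchange 2≤m z<s z<s z<s z<s
    (nLess-optimal 2≤m (s≤s (s≤s z≤n)) (¬exceptional-≢4 λ ()) (index-total (s≤s (s≤s (s≤s z≤n))) total))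
    (nLess-optimal 2≤m (s≤s (s≤s z≤n)) (¬exceptional-≢4 λ ()) (index-total (s≤s (s≤s (s≤s (s≤s z≤n)))) total))
    λ nLess≤x x<m → W-concave₃-at-1 (≤-trans (3≤nLess (≰⇒> m≰6)) nLess≤x) (part-total x<m ≤-refl total)
  L-concave₃-at {m} {k@(suc (suc _))} 2≤m 1≤k total with exceptional? m (1 + k) | exceptional? m (2 + k)
  ... | yes (refl , inj₁ refl)        | _                            = by-computation
  ... | yes (refl , inj₂ (inj₁ refl)) | _                            = by-computation
  ... | yes (refl , inj₂ (inj₂ refl)) | _                            = by-computation
  ... | no _                          | yes (refl , inj₁ refl)        = by-computation
  ... | no _                          | yes (refl , inj₂ (inj₁ refl)) = by-computation
  ... | no _                          | yes (refl , inj₂ (inj₂ refl)) = by-computation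
  ... | no ¬e₁                        | no ¬e₂                       = L-exchange 2≤m 1≤k z<s z<s z<s
    (nLess-optimal 2≤m (s≤s (s≤s z≤n)) ¬e₁ (index-total (n≤1+n (2 + k)) total))
    (nLess-optimal 2≤m (s≤s (s≤s z≤n)) ¬e₂ (index-total (n<1+n (2 + k)) total))
    λ nLess≤x x<m → W-concave₃ (nLess≤⇒1≤ 2≤m nLess≤x) (s≤s (s≤s z≤n)) (part-total x<m ≤-refl total)

  L-midpoint-odd-at : ∀ {m c s} → c ≡ suc (s + s) → 1 ≤ s → 2 ≤ m → ¬ Exceptional (c + c) m → m + (c + c) ≡ N →
                      L m c + L m c ≤ L m (c ∸ 1) + L m (suc c)
  L-midpoint-odd-at {m} {c} {s} refl 1≤s 2≤m ¬exc total with exceptional? m (s + s) | exceptional? m (2 + (s + s))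
  ... | yes (s+s≡4 , m∈) | _ = at-10 (double-injective {s} {2} s+s≡4) m∈
    where
    at-10 : s ≡ 2 → m ≡ 4 ⊎ m ≡ 6 ⊎ m ≡ 10 → L m c + L m c ≤ L m (c ∸ 1) + L m (suc c)
    at-10 refl (inj₁ refl)        = contradiction (refl , inj₂ (inj₂ refl)) ¬exc
    at-10 refl (inj₂ (inj₁ refl)) = by-computation
    at-10 refl (inj₂ (inj₂ refl)) = by-computation
  ... | no _ | yes (2+s+s≡4 , m∈) = at-6 (double-injective {s} {1} (suc-injective (suc-injective 2+s+s≡4))) m∈
    where
    at-6 : s ≡ 1 → m ≡ 4 ⊎ m ≡ 6 ⊎ m ≡ 10 → L m c + L m c ≤ L m (c ∸ 1) + L m (suc c)
    at-6 refl (inj₁ refl)        = contradiction (refl , inj₂ (inj₁ refl)) ¬exc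
    at-6 refl (inj₂ (inj₁ refl)) = by-computation
    at-6 refl (inj₂ (inj₂ refl)) = by-computation
  ... | no ¬e₁ | no ¬e₂ = L-exchange 2≤m z<s z<s 1≤u z<s
    (nLess-optimal 2≤m (+-mono-≤ 1≤s 1≤s) ¬e₁ (index-total (m≤m+n (suc u) (suc u)) total))
    (nLess-optimal 2≤m (m≤m+n 2 _) ¬e₂ (index-total (+-monoʳ-≤ 2 (m<m+n u 1≤u)) total′))
    λ nLess≤x x<m → W-midpoint-odd (nLess≤⇒1≤ 2≤m nLess≤x) 1≤s (part-total x<m (+-monoʳ-≤ 2 (m≤m+n u u)) total′)
    where
    u = s + s
    1≤u = ≤-trans 1≤s (m≤m+n s s)
    total′ : m + (2 + (u + u)) ≡ N
    total′ = trans (cong (m +_) (sym (pairs u 1 1))) total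

  L-midpoint-even-at : ∀ {m c r} → c ≡ 2 + (r + r) → 2 ≤ m → ¬ Exceptional (c + c) m → m + (c + c) ≡ N →
                       L m (c ∸ 1) + L m (suc c) ≤ L m c + L m c
  L-midpoint-even-at {m} {c} {zero} refl 2≤m ¬exc total with m ≤? 6
  ... | yes m≤6 = L-midpoint-2-small 2≤m m≤6 λ { refl → ¬exc (refl , inj₁ refl) }
  ... | no m≰6  = L-exchange 2≤m z<s z<s z<s z<s optimal-2 optimal-2
    λ nLess≤x x<m → W-midpoint-2 (≤-trans (3≤nLess (≰⇒> m≰6)) nLess≤x) (part-total x<m (n≤1+n 3) total)
    where
    optimal-2 = nLess-optimal 2≤m (s≤s (s≤s z≤n)) (¬exceptional-≢4 λ ()) (index-total (s≤s (s≤s (s≤s z≤n))) total)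
  L-midpoint-even-at {m} {c} {r@(suc _)} refl 2≤m ¬exc total with exceptional? m c
  ... | yes (c≡4 , m∈) = at-8 (double-injective {r} {1} (suc-injective (suc-injective c≡4))) m∈
    where
    at-8 : r ≡ 1 → m ≡ 4 ⊎ m ≡ 6 ⊎ m ≡ 10 → L m (c ∸ 1) + L m (suc c) ≤ L m c + L m c
    at-8 refl (inj₁ refl)        = by-computation
    at-8 refl (inj₂ (inj₁ refl)) = by-computation
    at-8 refl (inj₂ (inj₂ refl)) = by-computation
  ... | no ¬e = L-exchange 2≤m z<s z<s z<s z<s optimal-c optimal-c
    λ nLess≤x x<m → W-midpoint-even (nLess≤⇒1≤ 2≤m nLess≤x) z<s (part-total x<m (m<m+n c {c} z<s) total)
    where
    optimal-c = nLess-optimal 2≤m (m≤m+n 2 _) ¬e (index-total (m<n+m c {c} z<s) total)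

  W-odd-at : ∀ {n m c} → n ≡ suc (c + c) → 1 ≤ c → 2 ≤ m → n + m ≡ N → W n m ≡ splitValue n m c
  W-odd-at {n} {m} {c} refl 1≤c 2≤m n+m≡N = W≡best-split 2≤m 1≤c (n≤1+n _) λ 1≤k k+k≤n → begin
    splitValue n m _      ≤⟨ odd-split≤center {L m} {c} (L-concave₃-below 2≤m (index-total ≤-refl total)) 1≤k k+k≤n ⟩
    L m c + L m (suc c)   ≡⟨ cong (λ y → L m c + L m y) (sym (trans (cong (_∸ c) (sym (+-suc c c))) (m+n∸m≡n c (suc c)))) ⟩
    splitValue n m c      ∎
    where
    open ≤-Reasoning
    total = trans (+-comm m n) n+m≡N

  W-4t-at : ∀ {n m c r} → c ≡ 2 + (r + r) → n ≡ c + c → 2 ≤ m → ¬ Exceptional n m → n + m ≡ N →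
               W n m ≡ splitValue n m c
  W-4t-at {n} {m} {c} {r} refl refl 2≤m ¬exc n+m≡N = W≡best-split 2≤m z<s ≤-refl λ 1≤k k+k≤n → begin
    splitValue n m _                               ≤⟨ even-split≤center {L m} {c} (L-concave₃-below 2≤m (index-total ≤-refl total)) 1≤k k+k≤n ⟩
    (L m c + L m c) ⊔ (L m (c ∸ 1) + L m (suc c))  ≤⟨ ⊔-lub ≤-refl (L-midpoint-even-at {r = r} refl 2≤m ¬exc total) ⟩
    L m c + L m c                                  ≡⟨ cong (λ y → L m c + L m y) (sym (m+n∸m≡n c c)) ⟩
    splitValue n m c                               ∎
    where
    open ≤-Reasoning
    total = trans (+-comm m n) n+m≡N

  W-4t+2-at : ∀ {n m c s} → c ≡ suc (s + s) → 1 ≤ s → n ≡ c + c → 2 ≤ m → ¬ Exceptional n m → n + m ≡ N →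
                 W n m ≡ splitValue n m (s + s)
  W-4t+2-at {n} {m} {c} {s} refl 1≤s refl 2≤m ¬exc n+m≡N = W≡best-split 2≤m 1≤u u+u≤n λ 1≤k k+k≤n → begin
    splitValue n m _                               ≤⟨ even-split≤center {L m} {c} (L-concave₃-below 2≤m (index-total ≤-refl total)) 1≤k k+k≤n ⟩
    (L m c + L m c) ⊔ (L m (c ∸ 1) + L m (suc c))  ≤⟨ ⊔-lub (L-midpoint-odd-at refl 1≤s 2≤m ¬exc total) ≤-refl ⟩
    L m u + L m (2 + u)                            ≡⟨ cong (λ y → L m u + L m y) (sym n∸u≡2+u) ⟩
    splitValue n m u                               ∎
    where
    open ≤-Reasoning
    u = s + s
    1≤u = ≤-trans 1≤s (m≤m+n s s)
    total = trans (+-comm m n) n+m≡N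
    u+u≤n = +-mono-≤ (n≤1+n u) (n≤1+n u)
    n∸u≡2+u = trans (cong (_∸ u) (trans (pairs u 1 1) (sym (pairs u 0 2)))) (m+n∸m≡n u (2 + u))

  nLess-optimal-at : ∀ {n m} → 2 ≤ n → 2 ≤ m → ¬ Exceptional n m → n + m ≡ N → NLessOptimal n m
  nLess-optimal-at {n} {m} 2≤n 2≤m ¬exc n+m≡N with evenOdd n
  ... | odd zero          = contradiction 2≤n λ { (s≤s ()) }
  ... | odd c@(suc _)     = nLess-optimal-by {n} {m} (nLess-odd c) (W-odd-at refl z<s 2≤m n+m≡N)
  ... | even c with evenOdd c
  ...   | even zero       = contradiction 2≤n λ ()
  ...   | even t@(suc r)  = nLess-optimal-by {n} {m} (nLess-4t t) (W-4t-at {r = r} (pairs r 1 1) refl 2≤m ¬exc n+m≡N)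
  ...   | odd zero        = nLess-optimal-by {2} {m} refl (W[2,m]≡L+L 2≤m)
  ...   | odd s@(suc _)   = nLess-optimal-by {n} {m} (trans (cong nLess (pairs (s + s) 1 1)) (nLess-4t+2 z<s))
                                             (W-4t+2-at refl z<s refl 2≤m ¬exc n+m≡N)

facts : ∀ N → FactsBelow N
facts zero    = record { nLess-optimal = λ _ _ _ () ; L-concave₃ = λ _ _ () }
facts (suc N) = record { nLess-optimal = nLess-optimal′ ; L-concave₃ = L-concave₃′ }
  where
  open FactsBelow (facts N)
  open InductionStep (facts N)
  nLess-optimal′ : ∀ {n m} → 2 ≤ n → 2 ≤ m → ¬ Exceptional n m → n + m < suc N → NLessOptimal n m
  nLess-optimal′ 2≤n 2≤m ¬exc n+m≤N with m≤n⇒m<n∨m≡n (≤-pred n+m≤N)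
  ... | inj₁ n+m<N = nLess-optimal 2≤n 2≤m ¬exc n+m<N
  ... | inj₂ n+m≡N = nLess-optimal-at 2≤n 2≤m ¬exc n+m≡N
  L-concave₃′ : ∀ {m k} → 2 ≤ m → 1 ≤ k → m + (3 + k) < suc N → Concave₃At (L m) k
  L-concave₃′ 2≤m 1≤k m+3+k≤N with m≤n⇒m<n∨m≡n (≤-pred m+3+k≤N)
  ... | inj₁ m+3+k<N = L-concave₃ 2≤m 1≤k m+3+k<N
  ... | inj₂ m+3+k≡N = L-concave₃-at 2≤m 1≤k m+3+k≡N

nLess-optimal : ∀ {n m} → 2 ≤ n → 2 ≤ m → ¬ Exceptional n m → NLessOptimal n m
nLess-optimal {n} {m} 2≤n 2≤m ¬exc = FactsBelow.nLess-optimal (facts (suc (n + m))) 2≤n 2≤m ¬exc ≤-refl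

S≡nLess : ∀ {n m} → ¬ Exceptional (2 + n) (2 + m) → S (2 + n) (2 + m) ≡ nLess (2 + n)
S≡nLess {n} {m} ¬exc with 2 + m ≟ 4
... | yes refl rewrite dec-false (2 + n ≟ 4) (λ n≡4 → ¬exc (refl , inj₁ n≡4))
                     | dec-false (2 + n ≟ 6) (λ n≡6 → ¬exc (refl , inj₂ (inj₁ n≡6)))
                     | dec-false (2 + n ≟ 10) (λ n≡10 → ¬exc (refl , inj₂ (inj₂ n≡10))) = refl
... | no m≢4 rewrite dec-false (2 + m ≟ 4) m≢4 | ∧-zeroʳ (2 + n ≡ᵇ 4) | ∧-zeroʳ (2 + n ≡ᵇ 6) | ∧-zeroʳ (2 + n ≡ᵇ 10) = refl

theorem1p1 : (n m : ℕ) → 1 ≤ n → 1 ≤ m → Optimal n m (S n m)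
theorem1p1 1 m _ 1≤m = guess-optimal {1} {m} z<s 1≤m refl
theorem1p1 n@(suc (suc _)) 1 _ _ rewrite ∨-zeroʳ (n ≡ᵇ 1) = guess-optimal {n} {1} z<s z<s (W[n,1]≡1 {n})
theorem1p1 n@(suc (suc _)) m@(suc (suc _)) _ _ with exceptional? n m
... | yes (refl , inj₁ refl)        = question-optimal {4} {4} {1} z<s z<s by-computation refl
... | yes (refl , inj₂ (inj₁ refl)) = question-optimal {6} {4} {3} z<s z<s by-computation refl
... | yes (refl , inj₂ (inj₂ refl)) = question-optimal {10} {4} {5} z<s z<s by-computation refl
... | no ¬exc rewrite S≡nLess ¬exc =
  question-optimal {n} {m} z<s (proj₁ bounds) (proj₂ bounds) (nLess-optimal (s≤s (s≤s z≤n)) (s≤s (s≤s z≤n)) ¬exc)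
  where bounds = nLess-bounds {n} (s≤s (s≤s z≤n))
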